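{- For each $n\ge1$ and each type $i\in\{I,II,III\}$, let $c_n$ be the number of elements labeled $c$ (edges and loops) in a dimer covering of type $i$ of the Schreier graph $\Sigma_n$ of the Hanoi Towers group, chosen uniformly at random among all dimer coverings of type $i$. Let $\mu_{n,i}$ and $\sigma^2_{n,i}$ denote its mean and variance. Then $$\mu_{n,I}=\frac{3^{n-1}+1}{2},\quad \mu_{n,II}=\frac{3^{n-1}+3}{2},\quad \mu_{n,III}=\frac{3^{n-1}-1}{2},$$ $$\sigma^2_{n,I}=\frac{3^n-6n+3}{4},\quad\sigma^2_{n,II}=\frac{3^n+10n-13}{4},\quad \sigma^2_{n,III}=\frac{3^n-2n-1}{4}.$$
   Context: The Hanoi Towers group is generated by $a,b,c$ acting on ternary words, defined recursively for any ternary word $w$ by - $a(0w)=1w$, $a(1w)=0w$, $a(2w)=2a(w)$; - $b(0w)=2w$, $b(2w)=0w$, $b(1w)=1b(w)$; - $c(1w)=2w$, $c(2w)=1w$, $c(0w)=0c(w)$. $\Sigma_n$ has vertex set $\{0,1,2\}^n$, one edge labeled $s$ for each unordered pair $\{u,s(u)\}$ with $s(u)\ne u$, and loops labeled $c$ at $0^n$, $b$ at $1^n$, and $a$ at $2^n$. A dimer covering is a set of edges, loops allowed, covering each vertex exactly once (a loop covers its vertex). A covering is of - type I if it contains all three loops; - type II if it contains only the loop at $0^n$; - type III if it contains only the loop at $1^n$. In counting $c_n$, the loop at $0^n$, which is labeled $c$, counts as an element labeled $c$. -}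

module Defs where

open import Data.Nat as ℕ using (ℕ; zero; suc; _<_; _<?_; _^_)
open import Data.Fin using (Fin; zero; suc; toℕ)
import Data.Fin as Fin
open import Data.Vec as Vec using (Vec; []; _∷_; replicate)
import Data.Vec.Properties as VecP
open import Data.List as List using (List; []; _∷_; _++_; length; filter; map; concatMap)
open import Data.List.Relation.Unary.All using (All)
open import Data.List.Relation.Unary.All using (all?) public
open import Data.List.Membership.Propositional using (_∈_; _∉_)
open import Data.List.Membership.DecPropositional using () renaming (_∈?_ to ∈?-with)
open import Data.Product using (_×_; _,_)
open import Data.Sum using (_⊎_)
open import Relation.Binary.PropositionalEquality using (_≡_; refl; cong; cong₂)
open import Relation.Binary.Definitions using (DecidableEquality)
open import Relation.Nullary using (Dec; yes; no; ¬_)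
open import Relation.Nullary.Decidable using (_×-dec_; _⊎-dec_; ¬?; map′)
open import Data.Integer as ℤ using (ℤ; +_)
open import Data.Rational as ℚ using (ℚ; 0ℚ)

Word : ℕ → Set
Word n = Vec (Fin 3) n

data Gen : Set where
  a b c : Gen

l0 l1 l2 : Fin 3
l0 = zero
l1 = suc zero
l2 = suc (suc zero)

act : Gen → {n : ℕ} → Word n → Word n
act s [] = []
act a (zero ∷ w) = l1 ∷ w
act a (suc zero ∷ w) = l0 ∷ w
act a (suc (suc zero) ∷ w) = l2 ∷ act a w
act b (zero ∷ w) = l2 ∷ w
act b (suc (suc zero) ∷ w) = l0 ∷ w
act b (suc zero ∷ w) = l1 ∷ act b w
act c (suc zero ∷ w) = l2 ∷ w
act c (suc (suc zero) ∷ w) = l1 ∷ w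
act c (zero ∷ w) = l0 ∷ act c w

-- all ternary words of length n (the vertex set of Σ_n)
allWords : (n : ℕ) → List (Word n)
allWords zero = [] ∷ []
allWords (suc n) = concatMap (λ x → map (x ∷_) (allWords n)) (l0 ∷ l1 ∷ l2 ∷ [])

-- base-3 value of a word (injective on words of fixed length);
-- used only to pick one representative of each unordered pair {u, s(u)}
code : {n : ℕ} → Word n → ℕ
code [] = 0
code (x ∷ w) = toℕ x ℕ.+ 3 ℕ.* code w

data Edge (n : ℕ) : Set where
  edge : Gen → Word n → Word n → Edge n
  loop : Gen → Word n → Edge n

label : {n : ℕ} → Edge n → Gen
label (edge s _ _) = s
label (loop s _) = s

loop0 loop1 loop2 : (n : ℕ) → Edge n
loop0 n = loop c (replicate n l0)
loop1 n = loop b (replicate n l1)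
loop2 n = loop a (replicate n l2)

-- edges labeled s: one for each unordered pair {u, s(u)} with s(u) ≠ u
edgesOf : (n : ℕ) → Gen → List (Edge n)
edgesOf n s = map (λ u → edge s u (act s u))
                  (filter (λ u → code u <? code (act s u)) (allWords n))

-- the complete list of edges and loops of Σ_n (each element exactly once)
edgesΣ : (n : ℕ) → List (Edge n)
edgesΣ n = loop0 n ∷ loop1 n ∷ loop2 n ∷ (edgesOf n a ++ edgesOf n b ++ edgesOf n c)

_≟G_ : DecidableEquality Gen
a ≟G a = yes refl
a ≟G b = no λ ()
a ≟G c = no λ ()
b ≟G a = no λ ()
b ≟G b = yes refl
b ≟G c = no λ ()
c ≟G a = no λ ()
c ≟G b = no λ ()
c ≟G c = yes refl

_≟W_ : {n : ℕ} → DecidableEquality (Word n)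
_≟W_ = VecP.≡-dec Fin._≟_

_≟E_ : {n : ℕ} → DecidableEquality (Edge n)
edge s u v ≟E edge t x y with s ≟G t | u ≟W x | v ≟W y
... | yes refl | yes refl | yes refl = yes refl
... | no p | _ | _ = no λ { refl → p refl }
... | yes _ | no p | _ = no λ { refl → p refl }
... | yes _ | yes _ | no p = no λ { refl → p refl }
edge _ _ _ ≟E loop _ _ = no λ ()
loop _ _ ≟E edge _ _ _ = no λ ()
loop s u ≟E loop t x with s ≟G t | u ≟W x
... | yes refl | yes refl = yes refl
... | no p | _ = no λ { refl → p refl }
... | yes _ | no p = no λ { refl → p refl }

Covers : {n : ℕ} → Edge n → Word n → Set
Covers (edge _ u w) v = (u ≡ v) ⊎ (w ≡ v)
Covers (loop _ u) v = u ≡ v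

covers? : {n : ℕ} (e : Edge n) (v : Word n) → Dec (Covers e v)
covers? (edge _ u w) v = (u ≟W v) ⊎-dec (w ≟W v)
covers? (loop _ u) v = u ≟W v

coverCount : {n : ℕ} → List (Edge n) → Word n → ℕ
coverCount D v = length (filter (λ e → covers? e v) D)

-- all sub-lists (= subsets, as the elements of edgesΣ n are distinct)
sublists : {A : Set} → List A → List (List A)
sublists [] = [] ∷ []
sublists (x ∷ xs) = let r = sublists xs in r ++ map (x ∷_) r

IsDimerCovering : (n : ℕ) → List (Edge n) → Set
IsDimerCovering n D = All (λ v → coverCount D v ≡ 1) (allWords n)

isDimerCovering? : (n : ℕ) (D : List (Edge n)) → Dec (IsDimerCovering n D)
isDimerCovering? n D = all? (λ v → coverCount D v ℕ.≟ 1) (allWords n)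

data CovType : Set where
  I II III : CovType

_∈E?_ : {n : ℕ} (e : Edge n) (D : List (Edge n)) → Dec (e ∈ D)
e ∈E? D = ∈?-with _≟E_ e D

HasType : (n : ℕ) → CovType → List (Edge n) → Set
HasType n I   D = (loop0 n ∈ D) × (loop1 n ∈ D) × (loop2 n ∈ D)
HasType n II  D = (loop0 n ∈ D) × (loop1 n ∉ D) × (loop2 n ∉ D)
HasType n III D = (loop0 n ∉ D) × (loop1 n ∈ D) × (loop2 n ∉ D)

hasType? : (n : ℕ) (i : CovType) (D : List (Edge n)) → Dec (HasType n i D)
hasType? n I   D = (loop0 n ∈E? D) ×-dec ((loop1 n ∈E? D) ×-dec (loop2 n ∈E? D))
hasType? n II  D = (loop0 n ∈E? D) ×-dec (¬? (loop1 n ∈E? D) ×-dec ¬? (loop2 n ∈E? D))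
hasType? n III D = ¬? (loop0 n ∈E? D) ×-dec ((loop1 n ∈E? D) ×-dec ¬? (loop2 n ∈E? D))

coverings : (n : ℕ) → CovType → List (List (Edge n))
coverings n i = filter (λ D → isDimerCovering? n D ×-dec hasType? n i D) (sublists (edgesΣ n))

cCount : {n : ℕ} → List (Edge n) → ℕ
cCount D = length (filter (λ e → label e ≟G c) D)

fromℕℚ : ℕ → ℚ
fromℕℚ k = (+ k) ℚ./ 1

sumℚ : List ℚ → ℚ
sumℚ = List.foldr ℚ._+_ 0ℚ

-- average of a list (convention: 0 for the empty list)
meanℚ : List ℚ → ℚ
meanℚ [] = 0ℚ
meanℚ (q ∷ qs) = sumℚ (q ∷ qs) ℚ.* ((+ 1) ℚ./ suc (length qs))

μ : (n : ℕ) → CovType → ℚ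
μ n i = meanℚ (map (λ D → fromℕℚ (cCount D)) (coverings n i))

σ² : (n : ℕ) → CovType → ℚ
σ² n i = meanℚ (map (λ D → let d = fromℕℚ (cCount D) ℚ.- μ n i in d ℚ.* d) (coverings n i))

module Submission where

-- Σ_{n+1} consists of three copies of Σ_n (the words ending in 0, 1, 2), joined
-- by three bridges, one for each generator, at the corners s^n of the copies.
-- A set of edges of Σ_{n+1} is a dimer covering iff its part in each copy is
-- one, where a bridge in use acts in a copy like the loop at the corner it
-- leaves.  Encoding the coverings of Σ_n with prescribed loops by the linear
-- functional F ↦ Σ F(c-count) (a "dimer sum"), this yields a recurrence giving
-- each dimer sum of Σ_{n+1} as a sum of shifted triple convolutions of those of
-- Σ_n.  As 3^n is odd, the sums with an even number of loops vanish, so each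
-- remaining one is the mixture of two triple convolutions; mass, mean and
-- variance then follow by induction on n, and the rational mean and variance
-- of the theorem are read off from them.

module SubsetSums where

  open import Data.Nat using (ℕ; _+_; _*_)
  open import Data.Nat.Properties using (+-identityʳ; *-distribˡ-+)
  open import Data.Nat.ListAction using (sum)
  open import Data.Nat.ListAction.Properties using (sum-++)
  open import Data.List using (List; []; _∷_; _++_; map; filter)
  open import Data.List.Properties using (map-++; map-∘)
  open import Data.List.Relation.Unary.All using (All; []; _∷_)
  open import Data.List.Relation.Binary.Permutation.Propositional
    using (_↭_; prep; swap) renaming (refl to ↭-refl; trans to ↭-trans)
  open import Relation.Binary.PropositionalEquality
    using (_≡_; refl; sym; trans; cong; cong₂; module ≡-Reasoning)
  open import Relation.Nullary using (Dec; yes; no)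
  open import Relation.Nullary.Decidable using (_×-dec_)
  open import Data.Empty using (⊥-elim)
  open import Data.Nat.Tactic.RingSolver using (solve-∀)
  open import Defs using (sublists)

  𝟙 : ∀ {p} {P : Set p} → Dec P → ℕ
  𝟙 (yes _) = 1
  𝟙 (no _)  = 0

  𝟙-cong : ∀ {p q} {P : Set p} {Q : Set q} (d : Dec P) (e : Dec Q) →
           (P → Q) → (Q → P) → 𝟙 d ≡ 𝟙 e
  𝟙-cong (yes _) (yes _) _ _ = refl
  𝟙-cong (yes p) (no ¬q) f _ = ⊥-elim (¬q (f p))
  𝟙-cong (no ¬p) (yes q) _ g = ⊥-elim (¬p (g q))
  𝟙-cong (no _)  (no _)  _ _ = refl

  𝟙-× : ∀ {p q} {P : Set p} {Q : Set q} (d : Dec P) (e : Dec Q) →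
        𝟙 (d ×-dec e) ≡ 𝟙 d * 𝟙 e
  𝟙-× (yes _) (yes _) = refl
  𝟙-× (yes _) (no _)  = refl
  𝟙-× (no _)  _       = refl

  Σ⊆ : {A : Set} → List A → (List A → ℕ) → ℕ
  Σ⊆ []       g = g []
  Σ⊆ (x ∷ xs) g = Σ⊆ xs g + Σ⊆ xs (λ d → g (x ∷ d))

  Σ⊆-sublists : {A : Set} (E : List A) (g : List A → ℕ) → sum (map g (sublists E)) ≡ Σ⊆ E g
  Σ⊆-sublists []      g = +-identityʳ (g [])
  Σ⊆-sublists (x ∷ E) g = begin
    sum (map g (sublists E ++ map (x ∷_) (sublists E)))
      ≡⟨ cong sum (map-++ g (sublists E) _) ⟩
    sum (map g (sublists E) ++ map g (map (x ∷_) (sublists E)))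
      ≡⟨ sum-++ (map g (sublists E)) _ ⟩
    sum (map g (sublists E)) + sum (map g (map (x ∷_) (sublists E)))
      ≡⟨ cong₂ _+_ (Σ⊆-sublists E g)
                   (trans (cong sum (sym (map-∘ (sublists E)))) (Σ⊆-sublists E _)) ⟩
    Σ⊆ E g + Σ⊆ E (λ d → g (x ∷ d)) ∎
    where open ≡-Reasoning

  Σ⊆-cong : {A : Set} (E : List A) {g h : List A → ℕ} → (∀ d → g d ≡ h d) → Σ⊆ E g ≡ Σ⊆ E h
  Σ⊆-cong []      eq = eq []
  Σ⊆-cong (x ∷ E) eq = cong₂ _+_ (Σ⊆-cong E eq) (Σ⊆-cong E (λ d → eq (x ∷ d)))

  Σ⊆-cong-All : {A : Set} {P : A → Set} (E : List A) {g h : List A → ℕ} → All P E →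
                (∀ d → All P d → g d ≡ h d) → Σ⊆ E g ≡ Σ⊆ E h
  Σ⊆-cong-All []      _          eq = eq [] []
  Σ⊆-cong-All (x ∷ E) (px ∷ pE) eq =
    cong₂ _+_ (Σ⊆-cong-All E pE eq) (Σ⊆-cong-All E pE (λ d pd → eq (x ∷ d) (px ∷ pd)))

  private
    interchange : ∀ a b c d → (a + b) + (c + d) ≡ (a + c) + (b + d)
    interchange = solve-∀

  Σ⊆-↭ : {A : Set} {E E′ : List A} (g : List A → ℕ) →
         (∀ {d d′} → d ↭ d′ → g d ≡ g d′) → E ↭ E′ → Σ⊆ E g ≡ Σ⊆ E′ g
  Σ⊆-↭ g g-↭ ↭-refl = refl
  Σ⊆-↭ g g-↭ (prep x p) =
    cong₂ _+_ (Σ⊆-↭ g g-↭ p) (Σ⊆-↭ (λ d → g (x ∷ d)) (λ q → g-↭ (prep x q)) p)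
  Σ⊆-↭ g g-↭ (↭-trans p q) = trans (Σ⊆-↭ g g-↭ p) (Σ⊆-↭ g g-↭ q)
  Σ⊆-↭ {E = x ∷ y ∷ xs} {E′ = .y ∷ .x ∷ ys} g g-↭ (swap .x .y p) = begin
    (Σ⊆ xs g + Σ⊆ xs gy) + (Σ⊆ xs gx + Σ⊆ xs gxy)
      ≡⟨ cong₂ _+_ (cong₂ _+_ (Σ⊆-↭ g g-↭ p) (Σ⊆-↭ gy (λ q → g-↭ (prep y q)) p))
                   (cong₂ _+_ (Σ⊆-↭ gx (λ q → g-↭ (prep x q)) p)
                              (trans (Σ⊆-↭ gxy (λ q → g-↭ (prep x (prep y q))) p)
                                     (Σ⊆-cong ys (λ _ → g-↭ (swap x y ↭-refl))))) ⟩
    (Σ⊆ ys g + Σ⊆ ys gy) + (Σ⊆ ys gx + Σ⊆ ys gyx)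
      ≡⟨ interchange (Σ⊆ ys g) _ _ _ ⟩
    (Σ⊆ ys g + Σ⊆ ys gx) + (Σ⊆ ys gy + Σ⊆ ys gyx) ∎
    where
    open ≡-Reasoning
    gx gy gxy gyx : List _ → ℕ
    gx d  = g (x ∷ d)
    gy d  = g (y ∷ d)
    gxy d = g (x ∷ y ∷ d)
    gyx d = g (y ∷ x ∷ d)

  Σ⊆-++ : {A : Set} (xs ys : List A) (g : List A → ℕ) →
          Σ⊆ (xs ++ ys) g ≡ Σ⊆ xs (λ d → Σ⊆ ys (λ e → g (d ++ e)))
  Σ⊆-++ []       ys g = refl
  Σ⊆-++ (x ∷ xs) ys g = cong₂ _+_ (Σ⊆-++ xs ys g) (Σ⊆-++ xs ys (λ d → g (x ∷ d)))

  Σ⊆-map : {A B : Set} (f : A → B) (xs : List A) (g : List B → ℕ) →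
           Σ⊆ (map f xs) g ≡ Σ⊆ xs (λ d → g (map f d))
  Σ⊆-map f []       g = refl
  Σ⊆-map f (x ∷ xs) g = cong₂ _+_ (Σ⊆-map f xs g) (Σ⊆-map f xs (λ d → g (f x ∷ d)))

  Σ⊆-+ : {A : Set} (E : List A) (g h : List A → ℕ) → Σ⊆ E (λ d → g d + h d) ≡ Σ⊆ E g + Σ⊆ E h
  Σ⊆-+ []      g h = refl
  Σ⊆-+ (x ∷ E) g h =
    trans (cong₂ _+_ (Σ⊆-+ E g h) (Σ⊆-+ E (λ d → g (x ∷ d)) (λ d → h (x ∷ d))))
          (interchange (Σ⊆ E g) (Σ⊆ E h) _ _)

  Σ⊆-* : {A : Set} (E : List A) (k : ℕ) (g : List A → ℕ) → Σ⊆ E (λ d → k * g d) ≡ k * Σ⊆ E g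
  Σ⊆-* []      k g = refl
  Σ⊆-* (x ∷ E) k g = trans (cong₂ _+_ (Σ⊆-* E k g) (Σ⊆-* E k _)) (sym (*-distribˡ-+ k _ _))

  sum-filter : {A : Set} {P : A → Set} (P? : ∀ x → Dec (P x)) (f : A → ℕ) (xs : List A) →
               sum (map f (filter P? xs)) ≡ sum (map (λ x → 𝟙 (P? x) * f x) xs)
  sum-filter P? f []       = refl
  sum-filter P? f (x ∷ xs) with P? x
  ... | yes _ = cong₂ _+_ (sym (+-identityʳ (f x))) (sum-filter P? f xs)
  ... | no _  = sum-filter P? f xs

module Graph where

  open import Data.Nat using (ℕ; zero; suc; _+_; _*_; _^_; _<_; _<?_; _≤_; z≤n; s≤s; NonZero; >-nonZero)
  open import Data.Nat.Properties
    using (+-monoʳ-<; +-monoʳ-≤; *-monoʳ-<; *-monoʳ-≤; +-monoˡ-<; +-cancelʳ-<;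
           <⇒≱; <-irrefl; ≤-refl; m^n>0)
  open import Data.Fin using (Fin; zero; suc; toℕ)
  open import Data.Vec using ([]; _∷_; replicate; _∷ʳ_; head)
  open import Data.Vec.Properties using (∷-injective)
  open import Data.List using (List; []; _∷_; _++_; map; filter; concatMap)
  open import Data.List.Properties
    using (map-++; map-∘; ++-assoc; ++-identityʳ; concatMap-++; concatMap-map; map-concatMap;
           filter-accept; filter-reject)
    renaming (concatMap-cong to concatMap-cong′)
  open import Data.List.Relation.Binary.Permutation.Propositional
    using (_↭_; ↭-refl; ↭-trans; ↭-reflexive)
  open import Data.List.Relation.Binary.Permutation.Propositional.Properties
    using (++-commutativeMonoid; map⁺; filter-↭; ++⁺; ++⁺ˡ; ++⁺ʳ)
  import Algebra.Solver.CommutativeMonoid as CommutativeMonoidSolver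
  open import Relation.Binary.PropositionalEquality
  open import Relation.Nullary using (Dec; yes; no; ¬_)
  open import Data.Empty using (⊥-elim)
  open import Data.Product using (proj₁; proj₂)
  open import Data.Nat.Tactic.RingSolver using (solve-∀)
  open import Function using (_∘_)
  open import Defs

  module ++-Solver {A : Set} = CommutativeMonoidSolver (++-commutativeMonoid {A = A})

  -- The generator s fixes exactly one vertex of Σ_n, its corner s^n
  -- (the word 2…2 for a, 1…1 for b, 0…0 for c).
  cornerLetter : Gen → Fin 3
  cornerLetter a = l2
  cornerLetter b = l1
  cornerLetter c = l0

  corner : Gen → (n : ℕ) → Word n
  corner s n = replicate n (cornerLetter s)

  replicate-∷ʳ : ∀ n (x : Fin 3) → replicate (suc n) x ≡ replicate n x ∷ʳ x
  replicate-∷ʳ zero    x = refl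
  replicate-∷ʳ (suc n) x = cong (x ∷_) (replicate-∷ʳ n x)

  corner-fixed : ∀ s n → act s (corner s n) ≡ corner s n
  corner-fixed a zero    = refl
  corner-fixed b zero    = refl
  corner-fixed c zero    = refl
  corner-fixed a (suc n) = cong (l2 ∷_) (corner-fixed a n)
  corner-fixed b (suc n) = cong (l1 ∷_) (corner-fixed b n)
  corner-fixed c (suc n) = cong (l0 ∷_) (corner-fixed c n)

  -- Away from its corner, s acts on a prefix and ignores an appended letter:
  -- this is why Σ_{n+1} contains three copies of Σ_n, indexed by the last letter.
  act-∷ʳ : ∀ s {n} (u : Word n) x → u ≢ corner s n → act s (u ∷ʳ x) ≡ act s u ∷ʳ x
  act-∷ʳ a [] x ne = ⊥-elim (ne refl)
  act-∷ʳ b [] x ne = ⊥-elim (ne refl)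
  act-∷ʳ c [] x ne = ⊥-elim (ne refl)
  act-∷ʳ a (zero ∷ u)             x ne = refl
  act-∷ʳ a (suc zero ∷ u)         x ne = refl
  act-∷ʳ a (suc (suc zero) ∷ u)   x ne = cong (l2 ∷_) (act-∷ʳ a u x (ne ∘ cong (l2 ∷_)))
  act-∷ʳ b (zero ∷ u)             x ne = refl
  act-∷ʳ b (suc (suc zero) ∷ u)   x ne = refl
  act-∷ʳ b (suc zero ∷ u)         x ne = cong (l1 ∷_) (act-∷ʳ b u x (ne ∘ cong (l1 ∷_)))
  act-∷ʳ c (suc zero ∷ u)         x ne = refl
  act-∷ʳ c (suc (suc zero) ∷ u)   x ne = refl
  act-∷ʳ c (zero ∷ u)             x ne = cong (l0 ∷_) (act-∷ʳ c u x (ne ∘ cong (l0 ∷_)))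

  actLetter : Gen → Fin 3 → Fin 3
  actLetter s x = head (act s (x ∷ []))

  act-corner-∷ʳ : ∀ s n x → act s (corner s n ∷ʳ x) ≡ corner s n ∷ʳ actLetter s x
  act-corner-∷ʳ a zero zero             = refl
  act-corner-∷ʳ a zero (suc zero)       = refl
  act-corner-∷ʳ a zero (suc (suc zero)) = refl
  act-corner-∷ʳ b zero zero             = refl
  act-corner-∷ʳ b zero (suc zero)       = refl
  act-corner-∷ʳ b zero (suc (suc zero)) = refl
  act-corner-∷ʳ c zero zero             = refl
  act-corner-∷ʳ c zero (suc zero)       = refl
  act-corner-∷ʳ c zero (suc (suc zero)) = refl
  act-corner-∷ʳ a (suc n) x = cong (l2 ∷_) (act-corner-∷ʳ a n x)
  act-corner-∷ʳ b (suc n) x = cong (l1 ∷_) (act-corner-∷ʳ b n x)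
  act-corner-∷ʳ c (suc n) x = cong (l0 ∷_) (act-corner-∷ʳ c n x)

  code-∷ʳ : ∀ {n} (u : Word n) x → code (u ∷ʳ x) ≡ code u + 3 ^ n * toℕ x
  code-∷ʳ []          x = refl
  code-∷ʳ {suc n} (y ∷ u) x = trans (cong (λ z → toℕ y + 3 * z) (code-∷ʳ u x))
                                    (distribute (toℕ y) (code u) (3 ^ n) (toℕ x))
    where
    distribute : ∀ p q r s → p + 3 * (q + r * s) ≡ p + 3 * q + 3 * r * s
    distribute = solve-∀

  code-∷ʳ-< : ∀ {n} (u v : Word n) x → code u < code v → code (u ∷ʳ x) < code (v ∷ʳ x)
  code-∷ʳ-< {n} u v x lt rewrite code-∷ʳ u x | code-∷ʳ v x = +-monoˡ-< (3 ^ n * toℕ x) lt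

  code-∷ʳ-<⁻¹ : ∀ {n} (u v : Word n) x → code (u ∷ʳ x) < code (v ∷ʳ x) → code u < code v
  code-∷ʳ-<⁻¹ {n} u v x lt rewrite code-∷ʳ u x | code-∷ʳ v x =
    +-cancelʳ-< (3 ^ n * toℕ x) (code u) (code v) lt

  code-corner-< : ∀ {n} (w : Word n) x y → toℕ x < toℕ y → code (w ∷ʳ x) < code (w ∷ʳ y)
  code-corner-< {n} w x y lt rewrite code-∷ʳ w x | code-∷ʳ w y =
    +-monoʳ-< (code w) (*-monoʳ-< (3 ^ n) {{positive}} lt)
    where
    positive : NonZero (3 ^ n)
    positive = >-nonZero (m^n>0 3 n)

  code-corner-≮ : ∀ {n} (w : Word n) x y → toℕ y ≤ toℕ x → ¬ (code (w ∷ʳ x) < code (w ∷ʳ y))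
  code-corner-≮ {n} w x y le lt rewrite code-∷ʳ w x | code-∷ʳ w y =
    <⇒≱ lt (+-monoʳ-≤ (code w) (*-monoʳ-≤ (3 ^ n) le))

  concatMap-allWords : {B : Set} (n : ℕ) (h : Word (suc n) → List B) →
    concatMap h (allWords (suc n)) ≡
    concatMap (h ∘ (l0 ∷_)) (allWords n) ++ concatMap (h ∘ (l1 ∷_)) (allWords n)
      ++ concatMap (h ∘ (l2 ∷_)) (allWords n)
  concatMap-allWords n h =
    trans (concatMap-++ h (map (l0 ∷_) W) _)
    (cong₂ _++_ (concatMap-map h (l0 ∷_) W)
    (trans (concatMap-++ h (map (l1 ∷_) W) _)
    (cong₂ _++_ (concatMap-map h (l1 ∷_) W)
    (trans (concatMap-++ h (map (l2 ∷_) W) [])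
    (trans (++-identityʳ _) (concatMap-map h (l2 ∷_) W))))))
    where W = allWords n

  allWordsByLast : (n : ℕ) → List (Word (suc n))
  allWordsByLast n =
    map (_∷ʳ l0) (allWords n) ++ map (_∷ʳ l1) (allWords n) ++ map (_∷ʳ l2) (allWords n)

  -- Both enumerations list the same words: by induction, each of the nine
  -- blocks "first letter x, last letter y" appears in both.
  allWords-↭-byLast : (n : ℕ) → allWords (suc n) ↭ allWordsByLast n
  allWords-↭-byLast zero = ↭-refl
  allWords-↭-byLast (suc n) =
    ↭-trans (++⁺ (byFirst l0) (++⁺ (byFirst l1) (↭-trans (↭-reflexive (++-identityʳ _)) (byFirst l2))))
    (↭-trans (++-Solver.solve 9 (λ b₀₀ b₀₁ b₀₂ b₁₀ b₁₁ b₁₂ b₂₀ b₂₁ b₂₂ →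
         ((b₀₀ ⊕ (b₀₁ ⊕ b₀₂)) ⊕ ((b₁₀ ⊕ (b₁₁ ⊕ b₁₂)) ⊕ (b₂₀ ⊕ (b₂₁ ⊕ b₂₂))))
         ⊜ ((b₀₀ ⊕ (b₁₀ ⊕ b₂₀)) ⊕ ((b₀₁ ⊕ (b₁₁ ⊕ b₂₁)) ⊕ (b₀₂ ⊕ (b₁₂ ⊕ b₂₂))))) ↭-refl
         (block l0 l0) (block l0 l1) (block l0 l2) (block l1 l0) (block l1 l1)
         (block l1 l2) (block l2 l0) (block l2 l1) (block l2 l2))
     (↭-reflexive (sym (cong₂ _++_ (byLast l0) (cong₂ _++_ (byLast l1) (byLast l2))))))
    where
    open ++-Solver using (_⊕_; _⊜_)
    W = allWords n
    block : Fin 3 → Fin 3 → List (Word (suc (suc n)))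
    block x y = map (_∷ʳ y) (map (x ∷_) W)
    commute : ∀ x y → map (x ∷_) (map (_∷ʳ y) W) ≡ block x y
    commute x y = trans (sym (map-∘ W)) (map-∘ W)
    byFirst : ∀ x → map (x ∷_) (allWords (suc n)) ↭ block x l0 ++ block x l1 ++ block x l2
    byFirst x = ↭-trans (map⁺ (x ∷_) (allWords-↭-byLast n))
      (↭-reflexive (trans (map-++ (x ∷_) (map (_∷ʳ l0) W) _)
        (cong₂ _++_ (commute x l0)
          (trans (map-++ (x ∷_) (map (_∷ʳ l1) W) _) (cong₂ _++_ (commute x l1) (commute x l2))))))
    byLast : ∀ y → map (_∷ʳ y) (allWords (suc n)) ≡ block l0 y ++ block l1 y ++ block l2 y
    byLast y = trans (map-++ (_∷ʳ y) (map (l0 ∷_) W) _)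
      (cong (block l0 y ++_) (trans (map-++ (_∷ʳ y) (map (l1 ∷_) W) _)
      (cong (block l1 y ++_) (trans (map-++ (_∷ʳ y) (map (l2 ∷_) W) []) (++-identityʳ _)))))

  regroup : {B : Set} (y : Fin 3) (H H′ : Fin 3 → List B) (C : List B) →
    H y ↭ C ++ H′ y → (∀ z → z ≢ y → H z ≡ H′ z) →
    H l0 ++ H l1 ++ H l2 ↭ C ++ H′ l0 ++ H′ l1 ++ H′ l2
  regroup zero H H′ C split same rewrite same l1 (λ ()) | same l2 (λ ()) =
    ↭-trans (++⁺ʳ _ split) (↭-reflexive (++-assoc C (H′ l0) _))
  regroup (suc zero) H H′ C split same rewrite same l0 (λ ()) | same l2 (λ ()) =
    ↭-trans (++⁺ˡ (H′ l0) (++⁺ʳ (H′ l2) split))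
      (++-Solver.solve 4 (λ h₀ h₁ h₂ c → (h₀ ⊕ ((c ⊕ h₁) ⊕ h₂)) ⊜ (c ⊕ (h₀ ⊕ (h₁ ⊕ h₂))))
         ↭-refl (H′ l0) (H′ l1) (H′ l2) C)
    where open ++-Solver using (_⊕_; _⊜_)
  regroup (suc (suc zero)) H H′ C split same rewrite same l0 (λ ()) | same l1 (λ ()) =
    ↭-trans (++⁺ˡ (H′ l0) (++⁺ˡ (H′ l1) split))
      (++-Solver.solve 4 (λ h₀ h₁ h₂ c → (h₀ ⊕ (h₁ ⊕ (c ⊕ h₂))) ⊜ (c ⊕ (h₀ ⊕ (h₁ ⊕ h₂))))
         ↭-refl (H′ l0) (H′ l1) (H′ l2) C)
    where open ++-Solver using (_⊕_; _⊜_)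

  concatMap-isolate : {B : Set} (n : ℕ) (y : Fin 3) (h h′ : Word n → List B) →
    h′ (replicate n y) ≡ [] → (∀ u → u ≢ replicate n y → h u ≡ h′ u) →
    concatMap h (allWords n) ↭ h (replicate n y) ++ concatMap h′ (allWords n)
  concatMap-isolate zero y h h′ h′-y agree rewrite h′-y = ↭-refl
  concatMap-isolate (suc n) y h h′ h′-y agree =
    ↭-trans (↭-reflexive (concatMap-allWords n h))
    (↭-trans (regroup y (block h) (block h′) (h (replicate (suc n) y)) inner outer)
    (↭-reflexive (cong (h (replicate (suc n) y) ++_) (sym (concatMap-allWords n h′)))))
    where
    block : (Word (suc n) → List _) → Fin 3 → List _
    block g x = concatMap (g ∘ (x ∷_)) (allWords n)
    inner : block h y ↭ h (replicate (suc n) y) ++ block h′ y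
    inner = concatMap-isolate n y (h ∘ (y ∷_)) (h′ ∘ (y ∷_)) h′-y
              (λ u ne → agree (y ∷ u) (ne ∘ proj₂ ∘ ∷-injective))
    outer : ∀ z → z ≢ y → block h z ≡ block h′ z
    outer z ne = concatMap-cong′ (λ u → agree (z ∷ u) (ne ∘ proj₁ ∘ ∷-injective)) (allWords n)

  inCopy : {n : ℕ} → Fin 3 → Edge n → Edge (suc n)
  inCopy x (edge s u v) = edge s (u ∷ʳ x) (v ∷ʳ x)
  inCopy x (loop s u)   = loop s (u ∷ʳ x)

  bridge : Gen → (n : ℕ) → Edge (suc n)
  bridge a n = edge a (corner a n ∷ʳ l0) (corner a n ∷ʳ l1)
  bridge b n = edge b (corner b n ∷ʳ l0) (corner b n ∷ʳ l2)
  bridge c n = edge c (corner c n ∷ʳ l1) (corner c n ∷ʳ l2)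

  plainEdges : (n : ℕ) → List (Edge n)
  plainEdges n = edgesOf n a ++ edgesOf n b ++ edgesOf n c

  copies : (n : ℕ) → List (Edge (suc n))
  copies n = map (inCopy l0) (plainEdges n) ++ map (inCopy l1) (plainEdges n)
               ++ map (inCopy l2) (plainEdges n)

  -- edgesOf lists the s-edge {u, s(u)} at the endpoint u of smaller code;
  -- edgeAt s u is the (empty or one-element) list of the edge listed at u.
  edgeFrom : Gen → {n : ℕ} → Word n → Edge n
  edgeFrom s u = edge s u (act s u)

  listedAt? : (s : Gen) {n : ℕ} (u : Word n) → Dec (code u < code (act s u))
  listedAt? s u = code u <? code (act s u)

  edgeAt : (s : Gen) {n : ℕ} → Word n → List (Edge n)
  edgeAt s u = map (edgeFrom s) (filter (listedAt? s) (u ∷ []))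

  map-filter-concatMap : {A B : Set} {P : A → Set} (P? : ∀ x → Dec (P x)) (g : A → B) (xs : List A) →
    map g (filter P? xs) ≡ concatMap (λ u → map g (filter P? (u ∷ []))) xs
  map-filter-concatMap P? g []       = refl
  map-filter-concatMap P? g (x ∷ xs) with P? x
  ... | yes _ = cong (g x ∷_) (map-filter-concatMap P? g xs)
  ... | no _  = map-filter-concatMap P? g xs

  edgesOf-concatMap : ∀ n s → edgesOf n s ≡ concatMap (edgeAt s) (allWords n)
  edgesOf-concatMap n s = map-filter-concatMap (listedAt? s) (edgeFrom s) (allWords n)

  edgeAt-yes : ∀ s {n} (u : Word n) → code u < code (act s u) → edgeAt s u ≡ edgeFrom s u ∷ []
  edgeAt-yes s u lt = cong (map (edgeFrom s)) (filter-accept (listedAt? s) {x = u} {xs = []} lt)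

  edgeAt-no : ∀ s {n} (u : Word n) → ¬ (code u < code (act s u)) → edgeAt s u ≡ []
  edgeAt-no s u ≮ = cong (map (edgeFrom s)) (filter-reject (listedAt? s) {x = u} {xs = []} ≮)

  edgeAt-∷ʳ : ∀ s {n} (x : Fin 3) (u : Word n) → u ≢ corner s n →
              edgeAt s (u ∷ʳ x) ≡ map (inCopy x) (edgeAt s u)
  edgeAt-∷ʳ s x u ne with code u <? code (act s u)
  ... | yes lt = begin
    edgeAt s (u ∷ʳ x)
      ≡⟨ edgeAt-yes s (u ∷ʳ x) (subst (code (u ∷ʳ x) <_) (cong code (sym act≡)) (code-∷ʳ-< u (act s u) x lt)) ⟩
    edge s (u ∷ʳ x) (act s (u ∷ʳ x)) ∷ []
      ≡⟨ cong (λ v → edge s (u ∷ʳ x) v ∷ []) act≡ ⟩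
    map (inCopy x) (edgeFrom s u ∷ [])
      ≡⟨ cong (map (inCopy x)) (edgeAt-yes s u lt) ⟨
    map (inCopy x) (edgeAt s u) ∎
    where
    open ≡-Reasoning
    act≡ = act-∷ʳ s u x ne
  ... | no ≮ = begin
    edgeAt s (u ∷ʳ x)
      ≡⟨ edgeAt-no s (u ∷ʳ x) (≮ ∘ code-∷ʳ-<⁻¹ u (act s u) x ∘ subst (code (u ∷ʳ x) <_) code≡) ⟩
    []
      ≡⟨ cong (map (inCopy x)) (edgeAt-no s u ≮) ⟨
    map (inCopy x) (edgeAt s u) ∎
    where
    open ≡-Reasoning
    code≡ = cong code (act-∷ʳ s u x ne)

  -- Nothing is listed at a corner (it carries a loop, not an s-edge) …
  edgeAt-corner : ∀ s n → edgeAt s (corner s n) ≡ []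
  edgeAt-corner s n = edgeAt-no s (corner s n) (<-irrefl (cong code (sym (corner-fixed s n))))

  edgeAt-corner-∷ʳ-yes : ∀ s n x → toℕ x < toℕ (actLetter s x) →
    edgeAt s (corner s n ∷ʳ x) ≡ edge s (corner s n ∷ʳ x) (corner s n ∷ʳ actLetter s x) ∷ []
  edgeAt-corner-∷ʳ-yes s n x lt =
    trans (edgeAt-yes s (corner s n ∷ʳ x)
            (subst (λ v → code (corner s n ∷ʳ x) < code v) (sym (act-corner-∷ʳ s n x))
                   (code-corner-< (corner s n) x (actLetter s x) lt)))
          (cong (λ v → edge s (corner s n ∷ʳ x) v ∷ []) (act-corner-∷ʳ s n x))

  edgeAt-corner-∷ʳ-no : ∀ s n x → toℕ (actLetter s x) ≤ toℕ x → edgeAt s (corner s n ∷ʳ x) ≡ []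
  edgeAt-corner-∷ʳ-no s n x le =
    edgeAt-no s (corner s n ∷ʳ x)
      (code-corner-≮ (corner s n) x (actLetter s x) le
        ∘ subst (λ v → code (corner s n ∷ʳ x) < code v) (act-corner-∷ʳ s n x))

  bridge-listed : ∀ s n → edgeAt s (corner s n ∷ʳ l0) ++ edgeAt s (corner s n ∷ʳ l1)
                            ++ edgeAt s (corner s n ∷ʳ l2) ≡ bridge s n ∷ []
  bridge-listed a n rewrite edgeAt-corner-∷ʳ-yes a n l0 (s≤s z≤n) | edgeAt-corner-∷ʳ-no a n l1 z≤n
                          | edgeAt-corner-∷ʳ-no a n l2 ≤-refl = refl
  bridge-listed b n rewrite edgeAt-corner-∷ʳ-yes b n l0 (s≤s z≤n) | edgeAt-corner-∷ʳ-no b n l1 ≤-refl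
                          | edgeAt-corner-∷ʳ-no b n l2 z≤n = refl
  bridge-listed c n rewrite edgeAt-corner-∷ʳ-no c n l0 z≤n | edgeAt-corner-∷ʳ-yes c n l1 (s≤s (s≤s z≤n))
                          | edgeAt-corner-∷ʳ-no c n l2 (s≤s z≤n) = refl

  column-↭ : ∀ s n x → concatMap (λ u → edgeAt s (u ∷ʳ x)) (allWords n)
                         ↭ edgeAt s (corner s n ∷ʳ x) ++ map (inCopy x) (edgesOf n s)
  column-↭ s n x =
    ↭-trans (concatMap-isolate n (cornerLetter s) (λ u → edgeAt s (u ∷ʳ x))
               (map (inCopy x) ∘ edgeAt s) (cong (map (inCopy x)) (edgeAt-corner s n))
               (edgeAt-∷ʳ s x))
    (↭-reflexive (cong (edgeAt s (corner s n ∷ʳ x) ++_)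
       (trans (sym (map-concatMap (inCopy x) (edgeAt s) (allWords n)))
              (cong (map (inCopy x)) (sym (edgesOf-concatMap n s))))))

  edgesOf-↭ : ∀ s n → edgesOf (suc n) s ↭
    bridge s n ∷ (map (inCopy l0) (edgesOf n s) ++ map (inCopy l1) (edgesOf n s)
                    ++ map (inCopy l2) (edgesOf n s))
  edgesOf-↭ s n =
    ↭-trans (map⁺ (edgeFrom s) (filter-↭ (listedAt? s) (allWords-↭-byLast n)))
    (↭-trans (↭-reflexive (trans (map-filter-concatMap (listedAt? s) (edgeFrom s) (allWordsByLast n))
                                 byColumns))
    (↭-trans (++⁺ (column-↭ s n l0) (++⁺ (column-↭ s n l1) (column-↭ s n l2)))
    (↭-trans (++-Solver.solve 6 (λ c₀ c₁ c₂ m₀ m₁ m₂ →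
         ((c₀ ⊕ m₀) ⊕ ((c₁ ⊕ m₁) ⊕ (c₂ ⊕ m₂))) ⊜ ((c₀ ⊕ (c₁ ⊕ c₂)) ⊕ (m₀ ⊕ (m₁ ⊕ m₂)))) ↭-refl
         (C l0) (C l1) (C l2) (M l0) (M l1) (M l2))
    (↭-reflexive (cong (_++ (M l0 ++ M l1 ++ M l2)) (bridge-listed s n))))))
    where
    open ++-Solver using (_⊕_; _⊜_)
    W = allWords n
    C M G : Fin 3 → List (Edge (suc n))
    C x = edgeAt s (corner s n ∷ʳ x)
    M x = map (inCopy x) (edgesOf n s)
    G x = concatMap (λ u → edgeAt s (u ∷ʳ x)) W
    byColumns : concatMap (edgeAt s) (allWordsByLast n) ≡ G l0 ++ G l1 ++ G l2
    byColumns = trans (concatMap-++ (edgeAt s) (map (_∷ʳ l0) W) _)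
      (cong₂ _++_ (concatMap-map (edgeAt s) (_∷ʳ l0) W)
      (trans (concatMap-++ (edgeAt s) (map (_∷ʳ l1) W) _)
      (cong₂ _++_ (concatMap-map (edgeAt s) (_∷ʳ l1) W) (concatMap-map (edgeAt s) (_∷ʳ l2) W))))

  plainEdges-↭ : ∀ n → plainEdges (suc n) ↭ bridge a n ∷ bridge b n ∷ bridge c n ∷ copies n
  plainEdges-↭ n =
    ↭-trans (++⁺ (edgesOf-↭ a n) (++⁺ (edgesOf-↭ b n) (edgesOf-↭ c n)))
    (↭-trans (++-Solver.solve 12 (λ ba bb bc a₀ a₁ a₂ b₀ b₁ b₂ c₀ c₁ c₂ →
       ((ba ⊕ (a₀ ⊕ (a₁ ⊕ a₂))) ⊕ ((bb ⊕ (b₀ ⊕ (b₁ ⊕ b₂))) ⊕ (bc ⊕ (c₀ ⊕ (c₁ ⊕ c₂)))))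
       ⊜ (ba ⊕ (bb ⊕ (bc ⊕ ((a₀ ⊕ (b₀ ⊕ c₀)) ⊕ ((a₁ ⊕ (b₁ ⊕ c₁)) ⊕ (a₂ ⊕ (b₂ ⊕ c₂))))))))
       ↭-refl (bridge a n ∷ []) (bridge b n ∷ []) (bridge c n ∷ [])
       (E a l0) (E a l1) (E a l2) (E b l0) (E b l1) (E b l2) (E c l0) (E c l1) (E c l2))
     (↭-reflexive (cong (λ z → bridge a n ∷ bridge b n ∷ bridge c n ∷ z)
       (sym (cong₂ _++_ (copy l0) (cong₂ _++_ (copy l1) (copy l2)))))))
    where
    open ++-Solver using (_⊕_; _⊜_)
    E : Gen → Fin 3 → List (Edge (suc n))
    E s x = map (inCopy x) (edgesOf n s)
    copy : ∀ x → map (inCopy x) (plainEdges n) ≡ E a x ++ E b x ++ E c x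
    copy x = trans (map-++ (inCopy x) (edgesOf n a) _) (cong (E a x ++_) (map-++ (inCopy x) (edgesOf n b) _))

module Cover where

  open import Data.Nat using (ℕ; zero; suc; _+_; _*_)
  open import Data.Nat.Properties using (+-identityʳ; *-zeroʳ; *-distribˡ-+; *-comm)
  open import Data.Bool using (Bool; true; false)
  open import Data.Fin using (Fin; zero; suc)
  import Data.Fin as Fin
  open import Data.Vec using ([]; _∷_; replicate; _∷ʳ_; initLast)
  open import Data.Vec.Properties using (∷ʳ-injective)
  open import Data.List using (List; []; _∷_; _++_; map; filter; length)
  open import Data.List.Properties using (filter-++; length-++)
  open import Data.List.Relation.Unary.All as All using (All)
  open import Data.List.Relation.Unary.Any using (here)
  open import Data.List.Membership.Propositional using (_∈_)
  open import Data.List.Membership.Propositional.Properties using (∈-map⁺; ∈-++⁺ˡ; ∈-++⁺ʳ)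
  open import Data.List.Relation.Binary.Permutation.Propositional using (_↭_; prep)
  open import Data.List.Relation.Binary.Permutation.Propositional.Properties
    using (filter-↭; ↭-length)
  open import Relation.Binary.PropositionalEquality
  open import Relation.Nullary using (Dec; yes; no)
  open import Relation.Nullary.Decidable using (_×-dec_; _⊎-dec_)
  open import Data.Sum using (_⊎_; inj₁; inj₂)
  open import Data.Product using (_×_; _,_)
  open import Data.Nat.Tactic.RingSolver using (solve-∀)
  open import Defs
  open SubsetSums using (𝟙; 𝟙-cong; 𝟙-×)
  open Graph using (inCopy; bridge)

  count : {A : Set} {P : A → Set} → (∀ x → Dec (P x)) → List A → ℕ
  count P? D = length (filter P? D)

  count-∷ : {A : Set} {P : A → Set} (P? : ∀ x → Dec (P x)) (x : A) (D : List A) →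
            count P? (x ∷ D) ≡ 𝟙 (P? x) + count P? D
  count-∷ P? x D with P? x
  ... | yes _ = refl
  ... | no _  = refl

  count-++ : {A : Set} {P : A → Set} (P? : ∀ x → Dec (P x)) (D E : List A) →
             count P? (D ++ E) ≡ count P? D + count P? E
  count-++ P? D E = trans (cong length (filter-++ P? D E)) (length-++ (filter P? D))

  count-↭ : {A : Set} {P : A → Set} (P? : ∀ x → Dec (P x)) {D E : List A} → D ↭ E →
            count P? D ≡ count P? E
  count-↭ P? p = ↭-length (filter-↭ P? p)

  count-map : {A B : Set} {P : A → Set} {Q : B → Set} (P? : ∀ x → Dec (P x))
              (Q? : ∀ x → Dec (Q x)) (f : B → A) (k : ℕ) →
              (∀ x → 𝟙 (P? (f x)) ≡ k * 𝟙 (Q? x)) → (D : List B) → count P? (map f D) ≡ k * count Q? D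
  count-map P? Q? f k h []      = sym (*-zeroʳ k)
  count-map P? Q? f k h (x ∷ D) = begin
    count P? (f x ∷ map f D)          ≡⟨ count-∷ P? (f x) (map f D) ⟩
    𝟙 (P? (f x)) + count P? (map f D) ≡⟨ cong₂ _+_ (h x) (count-map P? Q? f k h D) ⟩
    k * 𝟙 (Q? x) + k * count Q? D     ≡⟨ *-distribˡ-+ k _ _ ⟨
    k * (𝟙 (Q? x) + count Q? D)       ≡⟨ cong (k *_) (count-∷ Q? x D) ⟨
    k * count Q? (x ∷ D)              ∎
    where open ≡-Reasoning

  bit : Bool → ℕ
  bit true  = 1
  bit false = 0

  keep : {A : Set} → Bool → A → List A → List A
  keep true  x d = x ∷ d
  keep false x d = d

  count-keep : {A : Set} {P : A → Set} (P? : ∀ x → Dec (P x)) (b : Bool) (x : A) (D : List A) →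
               count P? (keep b x D) ≡ bit b * 𝟙 (P? x) + count P? D
  count-keep P? true  x D = trans (count-∷ P? x D) (cong (_+ count P? D) (sym (+-identityʳ _)))
  count-keep P? false x D = refl

  keep-↭ : {A : Set} (b : Bool) (x : A) {d d′ : List A} → d ↭ d′ → keep b x d ↭ keep b x d′
  keep-↭ true  x p = prep x p
  keep-↭ false x p = p

  allWords-complete : ∀ n (v : Word n) → v ∈ allWords n
  allWords-complete zero [] = here refl
  allWords-complete (suc n) (zero ∷ w) = ∈-++⁺ˡ (∈-map⁺ (l0 ∷_) (allWords-complete n w))
  allWords-complete (suc n) (suc zero ∷ w) =
    ∈-++⁺ʳ (map (l0 ∷_) (allWords n)) (∈-++⁺ˡ (∈-map⁺ (l1 ∷_) (allWords-complete n w)))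
  allWords-complete (suc n) (suc (suc zero) ∷ w) =
    ∈-++⁺ʳ (map (l0 ∷_) (allWords n))
      (∈-++⁺ʳ (map (l1 ∷_) (allWords n)) (∈-++⁺ˡ (∈-map⁺ (l2 ∷_) (allWords-complete n w))))

  covering⇒ : ∀ n D → IsDimerCovering n D → ∀ v → coverCount D v ≡ 1
  covering⇒ n D cov v = All.lookup cov (allWords-complete n v)

  ⇒covering : ∀ n D → (∀ v → coverCount D v ≡ 1) → IsDimerCovering n D
  ⇒covering n D once = All.tabulate (λ {v} _ → once v)

  covering-↭ : ∀ n {D D′} → D ↭ D′ → IsDimerCovering n D → IsDimerCovering n D′
  covering-↭ n {D} {D′} p cov =
    ⇒covering n D′ (λ v → trans (sym (count-↭ (λ e → covers? e v) p)) (covering⇒ n D cov v))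

  covers-inCopy : ∀ {n} (x : Fin 3) (e : Edge n) (u : Word n) y →
                  𝟙 (covers? (inCopy x e) (u ∷ʳ y)) ≡ 𝟙 (x Fin.≟ y) * 𝟙 (covers? e u)
  covers-inCopy x e u y =
    trans (𝟙-cong (covers? (inCopy x e) (u ∷ʳ y)) ((x Fin.≟ y) ×-dec covers? e u) (to e) (from e))
          (𝟙-× (x Fin.≟ y) (covers? e u))
    where
    to : ∀ e → Covers (inCopy x e) (u ∷ʳ y) → (x ≡ y) × Covers e u
    to (edge s p q) (inj₁ eq) = let (p≡u , x≡y) = ∷ʳ-injective p u eq in x≡y , inj₁ p≡u
    to (edge s p q) (inj₂ eq) = let (q≡u , x≡y) = ∷ʳ-injective q u eq in x≡y , inj₂ q≡u
    to (loop s p)   eq        = let (p≡u , x≡y) = ∷ʳ-injective p u eq in x≡y , p≡u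
    from : ∀ e → (x ≡ y) × Covers e u → Covers (inCopy x e) (u ∷ʳ y)
    from (edge s p q) (refl , inj₁ refl) = inj₁ refl
    from (edge s p q) (refl , inj₂ refl) = inj₂ refl
    from (loop s p)   (refl , refl)      = refl

  covers-cornerLoop : ∀ n s (k : Fin 3) (u : Word n) y →
    𝟙 (covers? (loop s (replicate (suc n) k)) (u ∷ʳ y)) ≡ 𝟙 (replicate n k ≟W u) * 𝟙 (k Fin.≟ y)
  covers-cornerLoop n s k u y = begin
    𝟙 (covers? (loop s (replicate (suc n) k)) (u ∷ʳ y))
      ≡⟨ cong (λ w → 𝟙 (covers? (loop s w) (u ∷ʳ y))) (Graph.replicate-∷ʳ n k) ⟩
    𝟙 (covers? (inCopy k (loop s (replicate n k))) (u ∷ʳ y))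
      ≡⟨ covers-inCopy k (loop s (replicate n k)) u y ⟩
    𝟙 (k Fin.≟ y) * 𝟙 (replicate n k ≟W u)
      ≡⟨ *-comm (𝟙 (k Fin.≟ y)) _ ⟩
    𝟙 (replicate n k ≟W u) * 𝟙 (k Fin.≟ y) ∎
    where open ≡-Reasoning

  covers-bridge : ∀ {n} s (w : Word n) (p q : Fin 3) (u : Word n) y →
    𝟙 (covers? (edge s (w ∷ʳ p) (w ∷ʳ q)) (u ∷ʳ y)) ≡ 𝟙 (w ≟W u) * 𝟙 ((p Fin.≟ y) ⊎-dec (q Fin.≟ y))
  covers-bridge s w p q u y =
    trans (𝟙-cong (covers? (edge s (w ∷ʳ p) (w ∷ʳ q)) (u ∷ʳ y)) ((w ≟W u) ×-dec ((p Fin.≟ y) ⊎-dec (q Fin.≟ y)))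
                  to from)
          (𝟙-× (w ≟W u) ((p Fin.≟ y) ⊎-dec (q Fin.≟ y)))
    where
    to : Covers (edge s (w ∷ʳ p) (w ∷ʳ q)) (u ∷ʳ y) → (w ≡ u) × ((p ≡ y) ⊎ (q ≡ y))
    to (inj₁ eq) = let (w≡u , p≡y) = ∷ʳ-injective w u eq in w≡u , inj₁ p≡y
    to (inj₂ eq) = let (w≡u , q≡y) = ∷ʳ-injective w u eq in w≡u , inj₂ q≡y
    from : (w ≡ u) × ((p ≡ y) ⊎ (q ≡ y)) → Covers (edge s (w ∷ʳ p) (w ∷ʳ q)) (u ∷ʳ y)
    from (refl , inj₁ refl) = inj₁ refl
    from (refl , inj₂ refl) = inj₂ refl

  withLoops : ∀ n → Bool → Bool → Bool → List (Edge n) → List (Edge n)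
  withLoops n pc pb pa d = keep pc (loop0 n) (keep pb (loop1 n) (keep pa (loop2 n) d))

  withLoops-↭ : ∀ n pc pb pa {d d′} → d ↭ d′ → withLoops n pc pb pa d ↭ withLoops n pc pb pa d′
  withLoops-↭ n pc pb pa p = keep-↭ pc _ (keep-↭ pb _ (keep-↭ pa _ p))

  withBridges : ∀ n → Bool → Bool → Bool → List (Edge (suc n)) → List (Edge (suc n))
  withBridges n ea eb ec m = keep ea (bridge a n) (keep eb (bridge b n) (keep ec (bridge c n) m))

  inCopies : ∀ {n} → List (Edge n) → List (Edge n) → List (Edge n) → List (Edge (suc n))
  inCopies d₀ d₁ d₂ = map (inCopy l0) d₀ ++ map (inCopy l1) d₁ ++ map (inCopy l2) d₂

  module Restriction (n : ℕ) (Lc Lb La ea eb ec : Bool) (d₀ d₁ d₂ : List (Edge n)) where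

    whole : List (Edge (suc n))
    whole = withLoops (suc n) Lc Lb La (withBridges n ea eb ec (inCopies d₀ d₁ d₂))

    -- Its restriction to copy y: a bridge ending at a corner of copy y acts
    -- there like the loop of Σ_n at that corner.  (Copy 0 has its c-corner at
    -- 0^{n+1}, its b-corner on bridge b and its a-corner on bridge a, etc.)
    part : Fin 3 → List (Edge n)
    part zero             = withLoops n Lc eb ea d₀
    part (suc zero)       = withLoops n ec Lb ea d₁
    part (suc (suc zero)) = withLoops n ec eb La d₂

    private
      z : Fin 3 → Word n → ℕ
      z k u = 𝟙 (replicate n k ≟W u)
      δ : Fin 3 → Fin 3 → ℕ
      δ k y = 𝟙 (k Fin.≟ y)
      o : Fin 3 → Fin 3 → Fin 3 → ℕ
      o p q y = 𝟙 ((p Fin.≟ y) ⊎-dec (q Fin.≟ y))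

      expand-whole : ∀ u y → coverCount whole (u ∷ʳ y) ≡
        bit Lc * (z l0 u * δ l0 y) + (bit Lb * (z l1 u * δ l1 y) + (bit La * (z l2 u * δ l2 y) +
        (bit ea * (z l2 u * o l0 l1 y) + (bit eb * (z l1 u * o l0 l2 y) + (bit ec * (z l0 u * o l1 l2 y) +
        (δ l0 y * coverCount d₀ u + (δ l1 y * coverCount d₁ u + δ l2 y * coverCount d₂ u)))))))
      expand-whole u y =
        trans (count-keep P? Lc _ _) (cong₂ _+_ (cong (bit Lc *_) (covers-cornerLoop n c l0 u y))
        (trans (count-keep P? Lb _ _) (cong₂ _+_ (cong (bit Lb *_) (covers-cornerLoop n b l1 u y))
        (trans (count-keep P? La _ _) (cong₂ _+_ (cong (bit La *_) (covers-cornerLoop n a l2 u y))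
        (trans (count-keep P? ea _ _) (cong₂ _+_ (cong (bit ea *_) (covers-bridge a (replicate n l2) l0 l1 u y))
        (trans (count-keep P? eb _ _) (cong₂ _+_ (cong (bit eb *_) (covers-bridge b (replicate n l1) l0 l2 u y))
        (trans (count-keep P? ec _ _) (cong₂ _+_ (cong (bit ec *_) (covers-bridge c (replicate n l0) l1 l2 u y))
        (trans (count-++ P? (map (inCopy l0) d₀) _)
          (cong₂ _+_ (copy l0 d₀)
          (trans (count-++ P? (map (inCopy l1) d₁) _) (cong₂ _+_ (copy l1 d₁) (copy l2 d₂))))))))))))))))
        where
        P? = λ (e : Edge (suc n)) → covers? e (u ∷ʳ y)
        copy : ∀ x d → count P? (map (inCopy x) d) ≡ δ x y * coverCount d u
        copy x d = count-map P? (λ e → covers? e u) (inCopy x) (δ x y) (λ e → covers-inCopy x e u y) d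

      expand-withLoops : ∀ pc pb pa (d : List (Edge n)) u → coverCount (withLoops n pc pb pa d) u ≡
        bit pc * z l0 u + (bit pb * z l1 u + (bit pa * z l2 u + coverCount d u))
      expand-withLoops pc pb pa d u =
        trans (count-keep Q? pc _ _) (cong (bit pc * z l0 u +_)
        (trans (count-keep Q? pb _ _) (cong (bit pb * z l1 u +_) (count-keep Q? pa _ _))))
        where Q? = λ (e : Edge n) → covers? e u

      restrict₀ : ∀ Lc Lb La ea eb ec z₀ z₁ z₂ c₀ c₁ c₂ →
        Lc * (z₀ * 1) + (Lb * (z₁ * 0) + (La * (z₂ * 0) + (ea * (z₂ * 1) + (eb * (z₁ * 1) + (ec * (z₀ * 0)
        + (1 * c₀ + (0 * c₁ + 0 * c₂)))))))
        ≡ Lc * z₀ + (eb * z₁ + (ea * z₂ + c₀))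
      restrict₀ = solve-∀
      restrict₁ : ∀ Lc Lb La ea eb ec z₀ z₁ z₂ c₀ c₁ c₂ →
        Lc * (z₀ * 0) + (Lb * (z₁ * 1) + (La * (z₂ * 0) + (ea * (z₂ * 1) + (eb * (z₁ * 0) + (ec * (z₀ * 1)
        + (0 * c₀ + (1 * c₁ + 0 * c₂)))))))
        ≡ ec * z₀ + (Lb * z₁ + (ea * z₂ + c₁))
      restrict₁ = solve-∀
      restrict₂ : ∀ Lc Lb La ea eb ec z₀ z₁ z₂ c₀ c₁ c₂ →
        Lc * (z₀ * 0) + (Lb * (z₁ * 0) + (La * (z₂ * 1) + (ea * (z₂ * 0) + (eb * (z₁ * 1) + (ec * (z₀ * 1)
        + (0 * c₀ + (0 * c₁ + 1 * c₂)))))))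
        ≡ ec * z₀ + (eb * z₁ + (La * z₂ + c₂))
      restrict₂ = solve-∀

    coverCount-part : ∀ u y → coverCount whole (u ∷ʳ y) ≡ coverCount (part y) u
    coverCount-part u zero = trans (expand-whole u l0)
      (trans (restrict₀ (bit Lc) (bit Lb) (bit La) (bit ea) (bit eb) (bit ec) (z l0 u) (z l1 u) (z l2 u)
                        (coverCount d₀ u) (coverCount d₁ u) (coverCount d₂ u))
             (sym (expand-withLoops Lc eb ea d₀ u)))
    coverCount-part u (suc zero) = trans (expand-whole u l1)
      (trans (restrict₁ (bit Lc) (bit Lb) (bit La) (bit ea) (bit eb) (bit ec) (z l0 u) (z l1 u) (z l2 u)
                        (coverCount d₀ u) (coverCount d₁ u) (coverCount d₂ u))
             (sym (expand-withLoops ec Lb ea d₁ u)))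
    coverCount-part u (suc (suc zero)) = trans (expand-whole u l2)
      (trans (restrict₂ (bit Lc) (bit Lb) (bit La) (bit ea) (bit eb) (bit ec) (z l0 u) (z l1 u) (z l2 u)
                        (coverCount d₀ u) (coverCount d₁ u) (coverCount d₂ u))
             (sym (expand-withLoops ec eb La d₂ u)))

    covering-parts⇒ : IsDimerCovering (suc n) whole → ∀ y → IsDimerCovering n (part y)
    covering-parts⇒ cov y =
      ⇒covering n (part y) (λ u → trans (sym (coverCount-part u y)) (covering⇒ (suc n) whole cov (u ∷ʳ y)))

    ⇒covering-parts : (∀ y → IsDimerCovering n (part y)) → IsDimerCovering (suc n) whole
    ⇒covering-parts cov = ⇒covering (suc n) whole once
      where
      once : ∀ v → coverCount whole v ≡ 1
      once v with initLast v
      ... | u , y , refl = trans (coverCount-part u y) (covering⇒ n (part y) (cov y) u)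

    𝟙-covering-parts : 𝟙 (isDimerCovering? (suc n) whole) ≡
      𝟙 (isDimerCovering? n (part l0)) * (𝟙 (isDimerCovering? n (part l1)) * 𝟙 (isDimerCovering? n (part l2)))
    𝟙-covering-parts = begin
      𝟙 (isDimerCovering? (suc n) whole)
        ≡⟨ 𝟙-cong (isDimerCovering? (suc n) whole) (cov? l0 ×-dec (cov? l1 ×-dec cov? l2))
             (λ cov → covering-parts⇒ cov l0 , covering-parts⇒ cov l1 , covering-parts⇒ cov l2)
             (λ { (c₀ , c₁ , c₂) → ⇒covering-parts λ { zero → c₀ ; (suc zero) → c₁ ; (suc (suc zero)) → c₂ } }) ⟩
      𝟙 (cov? l0 ×-dec (cov? l1 ×-dec cov? l2))
        ≡⟨ 𝟙-× (cov? l0) _ ⟩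
      𝟙 (cov? l0) * 𝟙 (cov? l1 ×-dec cov? l2)
        ≡⟨ cong (𝟙 (cov? l0) *_) (𝟙-× (cov? l1) (cov? l2)) ⟩
      𝟙 (cov? l0) * (𝟙 (cov? l1) * 𝟙 (cov? l2)) ∎
      where
      open ≡-Reasoning
      cov? : ∀ y → Dec (IsDimerCovering n (part y))
      cov? y = isDimerCovering? n (part y)

module Moments where

  open import Data.Nat using (ℕ; _+_; _*_)
  open import Data.Nat.Properties using (*-identityʳ; *-zeroʳ; *-distribˡ-+)
  open import Relation.Binary.PropositionalEquality
  open import Data.Nat.Tactic.RingSolver using (solve-∀)

  -- Weighted counts of a statistic are linear functionals F ↦ Σ_D w(D) F(c(D)).
  Functional : Set
  Functional = (ℕ → ℕ) → ℕ

  record Linear (X : Functional) : Set where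
    field
      cong-lin : ∀ {F G : ℕ → ℕ} → (∀ a → F a ≡ G a) → X F ≡ X G
      +-lin    : ∀ (F G : ℕ → ℕ) → X (λ a → F a + G a) ≡ X F + X G
      *-lin    : ∀ k (F : ℕ → ℕ) → X (λ a → k * F a) ≡ k * X F
  open Linear

  record Moments (X : Functional) (N S Q : ℕ) : Set where
    field
      mass   : X (λ _ → 1) ≡ N
      first  : X (λ a → a) ≡ S
      second : X (λ a → a * a) ≡ Q
  open Moments

  -- Law X N μ v: X has mass N, mean μ and variance v (as natural numbers).
  Law : Functional → ℕ → ℕ → ℕ → Set
  Law X N μ v = Moments X N (N * μ) (N * (μ * μ + v))

  Vanishes : Functional → Set
  Vanishes X = ∀ F → X F ≡ 0

  -- Convolution (the law of a sum of independent statistics), shift by a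
  -- constant, and sum of functionals.
  _⊗_ : Functional → Functional → Functional
  (X ⊗ Y) F = X (λ a → Y (λ b → F (a + b)))

  shift : ℕ → Functional → Functional
  shift k X F = X (λ a → F (k + a))

  _⊕_ : Functional → Functional → Functional
  (X ⊕ Y) F = X F + Y F

  infixr 7 _⊗_
  infixr 6 _⊕_

  Moments-≗ : ∀ {X Y N S Q} → (∀ F → X F ≡ Y F) → Moments Y N S Q → Moments X N S Q
  Moments-≗ eq M = record
    { mass = trans (eq _) (mass M) ; first = trans (eq _) (first M) ; second = trans (eq _) (second M) }

  Linear-⊗ : ∀ {X Y} → Linear X → Linear Y → Linear (X ⊗ Y)
  cong-lin (Linear-⊗ LX LY) eq  = cong-lin LX (λ a → cong-lin LY (λ b → eq (a + b)))
  +-lin    (Linear-⊗ LX LY) F G = trans (cong-lin LX (λ a → +-lin LY _ _)) (+-lin LX _ _)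
  *-lin    (Linear-⊗ LX LY) k F = trans (cong-lin LX (λ a → *-lin LY k _)) (*-lin LX k _)

  moments-quadratic : ∀ {X N S Q} → Linear X → Moments X N S Q → ∀ α β γ (F : ℕ → ℕ) →
    (∀ a → F a ≡ α * (a * a) + β * a + γ) → X F ≡ α * Q + β * S + γ * N
  moments-quadratic {X} {N} {S} {Q} L M α β γ F F≡ = begin
    X F                                                  ≡⟨ cong-lin L F≡ ⟩
    X (λ a → α * (a * a) + β * a + γ)                    ≡⟨ +-lin L _ _ ⟩
    X (λ a → α * (a * a) + β * a) + X (λ _ → γ)          ≡⟨ cong₂ _+_ (+-lin L _ _)
                                                              (cong-lin L (λ _ → sym (*-identityʳ γ))) ⟩
    (X (λ a → α * (a * a)) + X (λ a → β * a)) + X (λ _ → γ * 1)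
      ≡⟨ cong₂ _+_ (cong₂ _+_ (*-lin L α _) (*-lin L β _)) (*-lin L γ _) ⟩
    α * X (λ a → a * a) + β * X (λ a → a) + γ * X (λ _ → 1)
      ≡⟨ cong₂ _+_ (cong₂ _+_ (cong (α *_) (second M)) (cong (β *_) (first M))) (cong (γ *_) (mass M)) ⟩
    α * Q + β * S + γ * N                                ∎
    where open ≡-Reasoning

  Law-⊗ : ∀ {X Y N μ v N′ μ′ v′} → Linear X → Linear Y → Law X N μ v → Law Y N′ μ′ v′ →
          Law (X ⊗ Y) (N * N′) (μ + μ′) (v + v′)
  Law-⊗ {X} {Y} {N} {μ} {v} {N′} {μ′} {v′} LX LY MX MY = record
    { mass   = trans (moments-quadratic LX MX 0 0 N′ _ (λ a → trans (mass MY) (constant a N′)))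
                     (mass-rule N μ v N′)
    ; first  = trans (moments-quadratic LX MX 0 N′ (N′ * μ′) _
                       (λ a → trans (moments-quadratic LY MY 0 1 a _ (λ b → shifted a b)) (first-inner a N′ μ′ v′)))
                     (first-rule N μ v N′ μ′)
    ; second = trans (moments-quadratic LX MX N′ (2 * (N′ * μ′)) (N′ * (μ′ * μ′ + v′)) _
                       (λ a → trans (moments-quadratic LY MY 1 (2 * a) (a * a) _ (λ b → square a b))
                                    (second-inner a N′ μ′ v′)))
                     (second-rule N μ v N′ μ′ v′) }
    where
    constant : ∀ a N′ → N′ ≡ 0 * (a * a) + 0 * a + N′
    constant = solve-∀
    shifted : ∀ a b → a + b ≡ 0 * (b * b) + 1 * b + a
    shifted = solve-∀
    square : ∀ a b → (a + b) * (a + b) ≡ 1 * (b * b) + 2 * a * b + a * a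
    square = solve-∀
    mass-rule : ∀ N μ v N′ → 0 * (N * (μ * μ + v)) + 0 * (N * μ) + N′ * N ≡ N * N′
    mass-rule = solve-∀
    first-inner : ∀ a N′ μ′ v′ → 0 * (N′ * (μ′ * μ′ + v′)) + 1 * (N′ * μ′) + a * N′
                  ≡ 0 * (a * a) + N′ * a + N′ * μ′
    first-inner = solve-∀
    first-rule : ∀ N μ v N′ μ′ → 0 * (N * (μ * μ + v)) + N′ * (N * μ) + N′ * μ′ * N ≡ N * N′ * (μ + μ′)
    first-rule = solve-∀
    second-inner : ∀ a N′ μ′ v′ → 1 * (N′ * (μ′ * μ′ + v′)) + 2 * a * (N′ * μ′) + a * a * N′
                   ≡ N′ * (a * a) + 2 * (N′ * μ′) * a + N′ * (μ′ * μ′ + v′)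
    second-inner = solve-∀
    second-rule : ∀ N μ v N′ μ′ v′ →
      N′ * (N * (μ * μ + v)) + 2 * (N′ * μ′) * (N * μ) + N′ * (μ′ * μ′ + v′) * N
      ≡ N * N′ * ((μ + μ′) * (μ + μ′) + (v + v′))
    second-rule = solve-∀

  Law-shift : ∀ {X N μ v} k → Linear X → Law X N μ v → Law (shift k X) N (k + μ) v
  Law-shift {X} {N} {μ} {v} k L M = record
    { mass   = mass M
    ; first  = trans (moments-quadratic L M 0 1 k _ (shifted k)) (first-rule k N μ v)
    ; second = trans (moments-quadratic L M 1 (2 * k) (k * k) _ (square k)) (second-rule k N μ v) }
    where
    shifted : ∀ k a → k + a ≡ 0 * (a * a) + 1 * a + k
    shifted = solve-∀
    square : ∀ k a → (k + a) * (k + a) ≡ 1 * (a * a) + 2 * k * a + k * k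
    square = solve-∀
    first-rule : ∀ k N μ v → 0 * (N * (μ * μ + v)) + 1 * (N * μ) + k * N ≡ N * (k + μ)
    first-rule = solve-∀
    second-rule : ∀ k N μ v → 1 * (N * (μ * μ + v)) + 2 * k * (N * μ) + k * k * N
                  ≡ N * ((k + μ) * (k + μ) + v)
    second-rule = solve-∀

  -- Mixing two laws of equal mass: the means average and, as E[c²] averages,
  -- so does μ² + v.
  Law-mix : ∀ {X Y N μ₁ v₁ μ₂ v₂} μ v → Law X N μ₁ v₁ → Law Y N μ₂ v₂ →
            μ₁ + μ₂ ≡ 2 * μ → μ₁ * μ₁ + v₁ + (μ₂ * μ₂ + v₂) ≡ 2 * (μ * μ + v) →
            Law (X ⊕ Y) (2 * N) μ v
  Law-mix {N = N} {μ₁} {v₁} {μ₂} {v₂} μ v MX MY means squares = record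
    { mass   = trans (cong₂ _+_ (mass MX) (mass MY)) (double N)
    ; first  = trans (cong₂ _+_ (first MX) (first MY)) (average N μ₁ μ₂ μ means)
    ; second = trans (cong₂ _+_ (second MX) (second MY))
                     (average N (μ₁ * μ₁ + v₁) (μ₂ * μ₂ + v₂) (μ * μ + v) squares) }
    where
    double : ∀ N → N + N ≡ 2 * N
    double = solve-∀
    average : ∀ N x y m → x + y ≡ 2 * m → N * x + N * y ≡ 2 * N * m
    average N x y m x+y = begin
      N * x + N * y ≡⟨ *-distribˡ-+ N x y ⟨
      N * (x + y)   ≡⟨ cong (N *_) x+y ⟩
      N * (2 * m)   ≡⟨ reassociate N m ⟩
      2 * N * m     ∎
      where
      open ≡-Reasoning
      reassociate : ∀ N m → N * (2 * m) ≡ 2 * N * m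
      reassociate = solve-∀

  vanishes-⊗ˡ : ∀ {X} Y → Vanishes X → Vanishes (X ⊗ Y)
  vanishes-⊗ˡ Y X≡0 F = X≡0 _

  vanishes-⊗ʳ : ∀ {X Y} → Linear X → Vanishes Y → Vanishes (X ⊗ Y)
  vanishes-⊗ʳ {X} L Y≡0 F = begin
    X (λ a → _)      ≡⟨ cong-lin L (λ a → Y≡0 _) ⟩
    X (λ _ → 0)      ≡⟨ cong-lin L (λ _ → sym (*-zeroʳ 0)) ⟩
    X (λ _ → 0 * 0)  ≡⟨ *-lin L 0 (λ _ → 0) ⟩
    0                ∎
    where open ≡-Reasoning

  Law-⊗₃ : ∀ {X Y Z N μ₀ v₀ μ₁ v₁ μ₂ v₂} → Linear X → Linear Y → Linear Z →
           Law X N μ₀ v₀ → Law Y N μ₁ v₁ → Law Z N μ₂ v₂ → ∀ s →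
           Law (shift s (X ⊗ Y ⊗ Z)) (N * (N * N)) (s + (μ₀ + (μ₁ + μ₂))) (v₀ + (v₁ + v₂))
  Law-⊗₃ LX LY LZ MX MY MZ s =
    Law-shift s (Linear-⊗ LX (Linear-⊗ LY LZ)) (Law-⊗ LX (Linear-⊗ LY LZ) MX (Law-⊗ LY LZ MY MZ))

module Recurrence where

  open import Data.Nat using (ℕ; suc; _+_; _*_)
  open import Data.Nat.Properties using (*-distribˡ-+; *-identityˡ; +-identityʳ)
  open import Data.Bool using (Bool; true; false)
  open import Data.List using (List; map)
  open import Data.List.Relation.Binary.Permutation.Propositional using (_↭_; ↭-sym)
  open import Relation.Binary.PropositionalEquality
  open import Relation.Nullary using (Dec)
  open import Data.Nat.Tactic.RingSolver using (solve-∀)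
  open import Defs
  open SubsetSums
  open Graph using (inCopy; bridge; plainEdges; copies; plainEdges-↭)
  open Cover
  open Moments

  isC? : ∀ {n} (e : Edge n) → Dec (label e ≡ c)
  isC? e = label e ≟G c

  cCount-↭ : ∀ {n} {D D′ : List (Edge n)} → D ↭ D′ → cCount D ≡ cCount D′
  cCount-↭ = count-↭ isC?

  cCount-keep : ∀ {n} b (e : Edge n) D → cCount (keep b e D) ≡ bit b * 𝟙 (isC? e) + cCount D
  cCount-keep = count-keep isC?

  -- Of the loops only the one at 0^n, and of the bridges only bridge c, is labelled c.
  cCount-withLoops : ∀ n pc pb pa (d : List (Edge n)) → cCount (withLoops n pc pb pa d) ≡ bit pc + cCount d
  cCount-withLoops n pc pb pa d = begin
    cCount (withLoops n pc pb pa d)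
      ≡⟨ cCount-keep pc (loop0 n) _ ⟩
    bit pc * 1 + cCount (keep pb (loop1 n) (keep pa (loop2 n) d))
      ≡⟨ cong (bit pc * 1 +_) (trans (cCount-keep pb (loop1 n) _) (cong (bit pb * 0 +_) (cCount-keep pa (loop2 n) d))) ⟩
    bit pc * 1 + (bit pb * 0 + (bit pa * 0 + cCount d))
      ≡⟨ only-first (bit pc) (bit pb) (bit pa) (cCount d) ⟩
    bit pc + cCount d ∎
    where
    open ≡-Reasoning
    only-first : ∀ x y z w → x * 1 + (y * 0 + (z * 0 + w)) ≡ x + w
    only-first = solve-∀

  cCount-withBridges : ∀ n ea eb ec m → cCount (withBridges n ea eb ec m) ≡ bit ec + cCount m
  cCount-withBridges n ea eb ec m = begin
    cCount (withBridges n ea eb ec m)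
      ≡⟨ cCount-keep ea (bridge a n) _ ⟩
    bit ea * 0 + cCount (keep eb (bridge b n) (keep ec (bridge c n) m))
      ≡⟨ cong (bit ea * 0 +_) (trans (cCount-keep eb (bridge b n) _) (cong (bit eb * 0 +_) (cCount-keep ec (bridge c n) m))) ⟩
    bit ea * 0 + (bit eb * 0 + (bit ec * 1 + cCount m))
      ≡⟨ only-last (bit ea) (bit eb) (bit ec) (cCount m) ⟩
    bit ec + cCount m ∎
    where
    open ≡-Reasoning
    only-last : ∀ x y z w → x * 0 + (y * 0 + (z * 1 + w)) ≡ z + w
    only-last = solve-∀

  cCount-inCopies : ∀ {n} (d₀ d₁ d₂ : List (Edge n)) →
                    cCount (inCopies d₀ d₁ d₂) ≡ cCount d₀ + (cCount d₁ + cCount d₂)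
  cCount-inCopies d₀ d₁ d₂ =
    trans (count-++ isC? (map (inCopy l0) d₀) _)
      (cong₂ _+_ (copy l0 d₀) (trans (count-++ isC? (map (inCopy l1) d₁) _) (cong₂ _+_ (copy l1 d₁) (copy l2 d₂))))
    where
    same-label : ∀ {n} x (e : Edge n) → 𝟙 (isC? (inCopy x e)) ≡ 1 * 𝟙 (isC? e)
    same-label x (edge s u v) = sym (+-identityʳ _)
    same-label x (loop s u)   = sym (+-identityʳ _)
    copy : ∀ {n} x (d : List (Edge n)) → cCount (map (inCopy x) d) ≡ cCount d
    copy x d = trans (count-map isC? isC? (inCopy x) 1 (same-label x) d) (*-identityˡ _)

  isCovering : ∀ n → Bool → Bool → Bool → List (Edge n) → ℕ
  isCovering n pc pb pa d = 𝟙 (isDimerCovering? n (withLoops n pc pb pa d))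

  dimerSum : ∀ n → Bool → Bool → Bool → Functional
  dimerSum n pc pb pa F = Σ⊆ (plainEdges n) (λ d → isCovering n pc pb pa d * F (cCount d))

  Linear-dimerSum : ∀ n pc pb pa → Linear (dimerSum n pc pb pa)
  Linear-dimerSum n pc pb pa = record
    { cong-lin = λ eq → Σ⊆-cong (plainEdges n) (λ d → cong (w d *_) (eq (cCount d)))
    ; +-lin    = λ F G → trans (Σ⊆-cong (plainEdges n) (λ d → *-distribˡ-+ (w d) (F (cCount d)) (G (cCount d))))
                               (Σ⊆-+ (plainEdges n) _ _)
    ; *-lin    = λ k F → trans (Σ⊆-cong (plainEdges n) (λ d → swap (w d) k (F (cCount d))))
                               (Σ⊆-* (plainEdges n) k _) }
    where
    w = isCovering n pc pb pa
    swap : ∀ x k f → x * (k * f) ≡ k * (x * f)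
    swap = solve-∀

  isCovering-↭ : ∀ n pc pb pa {d d′} → d ↭ d′ → isCovering n pc pb pa d ≡ isCovering n pc pb pa d′
  isCovering-↭ n pc pb pa {d} {d′} p =
    𝟙-cong (isDimerCovering? n (withLoops n pc pb pa d)) (isDimerCovering? n (withLoops n pc pb pa d′))
           (covering-↭ n (withLoops-↭ n pc pb pa p)) (covering-↭ n (withLoops-↭ n pc pb pa (↭-sym p)))

  sumB : (Bool → ℕ) → ℕ
  sumB f = f false + f true

  sumB-cong : {f g : Bool → ℕ} → (∀ b → f b ≡ g b) → sumB f ≡ sumB g
  sumB-cong eq = cong₂ _+_ (eq false) (eq true)

  Σ⊆-copies : ∀ {n} (h : List (Edge (suc n)) → ℕ) →
    Σ⊆ (copies n) h ≡ Σ⊆ (plainEdges n) (λ d₀ → Σ⊆ (plainEdges n) (λ d₁ → Σ⊆ (plainEdges n) (λ d₂ →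
                        h (inCopies d₀ d₁ d₂))))
  Σ⊆-copies {n} h =
    trans (Σ⊆-++ (map (inCopy l0) E) _ h)
    (trans (Σ⊆-map (inCopy l0) E _)
    (Σ⊆-cong E (λ d₀ → trans (Σ⊆-++ (map (inCopy l1) E) _ _)
       (trans (Σ⊆-map (inCopy l1) E _) (Σ⊆-cong E (λ d₁ → Σ⊆-map (inCopy l2) E _))))))
    where E = plainEdges n

  branch : ∀ n (Lc Lb La ea eb ec : Bool) → Functional
  branch n Lc Lb La ea eb ec =
    shift (bit ec) (dimerSum n Lc eb ea ⊗ dimerSum n ec Lb ea ⊗ dimerSum n ec eb La)

  -- A covering of Σ_{n+1} is given by the bridges it uses and coverings of the
  -- three copies, whose loops are the used loops of Σ_{n+1} and the ends of the
  -- used bridges; bridge c contributes one c-edge.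
  recurrence : ∀ n Lc Lb La F → dimerSum (suc n) Lc Lb La F ≡
    sumB λ ea → sumB λ eb → sumB λ ec → branch n Lc Lb La ea eb ec F
  recurrence n Lc Lb La F =
    trans (Σ⊆-↭ g g-↭ (plainEdges-↭ n))
          (sumB-cong λ ea → sumB-cong λ eb → sumB-cong λ ec → split ea eb ec)
    where
    E = plainEdges n
    g : List (Edge (suc n)) → ℕ
    g d = isCovering (suc n) Lc Lb La d * F (cCount d)
    g-↭ : ∀ {d d′} → d ↭ d′ → g d ≡ g d′
    g-↭ p = cong₂ _*_ (isCovering-↭ (suc n) Lc Lb La p) (cong F (cCount-↭ p))
    split : ∀ ea eb ec → Σ⊆ (copies n) (λ m → g (withBridges n ea eb ec m)) ≡ branch n Lc Lb La ea eb ec F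
    split ea eb ec =
      trans (Σ⊆-copies (λ m → g (withBridges n ea eb ec m)))
      (Σ⊆-cong E λ d₀ → trans (Σ⊆-cong E λ d₁ → trans (Σ⊆-cong E λ d₂ → factor d₀ d₁ d₂)
                                                     (trans (Σ⊆-* E (w₀ d₀) _) (cong (w₀ d₀ *_) (Σ⊆-* E (w₁ d₁) _))))
                              (Σ⊆-* E (w₀ d₀) _))
      where
      w₀ = isCovering n Lc eb ea
      w₁ = isCovering n ec Lb ea
      w₂ = isCovering n ec eb La
      reassociate : ∀ x y z v → (x * (y * z)) * v ≡ x * (y * (z * v))
      reassociate = solve-∀
      factor : ∀ d₀ d₁ d₂ → g (withBridges n ea eb ec (inCopies d₀ d₁ d₂)) ≡
               w₀ d₀ * (w₁ d₁ * (w₂ d₂ * F (bit ec + (cCount d₀ + (cCount d₁ + cCount d₂)))))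
      factor d₀ d₁ d₂ =
        trans (cong₂ _*_ (Restriction.𝟙-covering-parts n Lc Lb La ea eb ec d₀ d₁ d₂)
                         (cong F (trans (cCount-withBridges n ea eb ec _) (cong (bit ec +_) (cCount-inCopies d₀ d₁ d₂)))))
              (reassociate (w₀ d₀) (w₁ d₁) (w₂ d₂) _)

module Laws where

  open import Data.Nat using (ℕ; zero; suc; _+_; _*_)
  open import Data.Nat.Properties using (+-identityʳ)
  open import Data.Bool using (Bool; true; false; not; _xor_)
  open import Relation.Binary.PropositionalEquality
  open import Data.Nat.Tactic.RingSolver using (solve-∀)
  open Cover using (bit)
  open Moments
  open Recurrence

  -- Parity: a covering of Σ_n (3^n vertices) uses an odd number of loops

  odd3 : Bool → Bool → Bool → Bool
  odd3 x y z = (x xor y) xor z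

  EvenVanish : ℕ → Set
  EvenVanish n = ∀ pc pb pa → odd3 pc pb pa ≡ false → Vanishes (dimerSum n pc pb pa)

  -- Given ea, the parity of the first (resp. second) copy forces eb (resp. ec).
  forced : Bool → Bool → Bool
  forced x ea = not (x xor ea)

  first-even : ∀ Lc ea → odd3 Lc (not (forced Lc ea)) ea ≡ false
  first-even false false = refl
  first-even false true  = refl
  first-even true  false = refl
  first-even true  true  = refl

  second-even : ∀ Lb ea → odd3 (not (forced Lb ea)) Lb ea ≡ false
  second-even false false = refl
  second-even false true  = refl
  second-even true  false = refl
  second-even true  true  = refl

  third-parity : ∀ Lc Lb La ea → odd3 (forced Lb ea) (forced Lc ea) La ≡ odd3 Lc Lb La
  third-parity false false La false = refl
  third-parity false false La true  = refl
  third-parity false true  La false = refl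
  third-parity false true  La true  = refl
  third-parity true  false La false = refl
  third-parity true  false La true  = refl
  third-parity true  true  La false = refl
  third-parity true  true  La true  = refl

  branch-vanishes₁ : ∀ n Lc Lb La ea eb ec → Vanishes (dimerSum n Lc eb ea) → Vanishes (branch n Lc Lb La ea eb ec)
  branch-vanishes₁ n Lc Lb La ea eb ec V F =
    vanishes-⊗ˡ (dimerSum n ec Lb ea ⊗ dimerSum n ec eb La) V (λ a → F (bit ec + a))

  branch-vanishes₂ : ∀ n Lc Lb La ea eb ec → Vanishes (dimerSum n ec Lb ea) → Vanishes (branch n Lc Lb La ea eb ec)
  branch-vanishes₂ n Lc Lb La ea eb ec V F =
    vanishes-⊗ʳ (Linear-dimerSum n Lc eb ea) (vanishes-⊗ˡ (dimerSum n ec eb La) V) (λ a → F (bit ec + a))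

  branch-vanishes₃ : ∀ n Lc Lb La ea eb ec → Vanishes (dimerSum n ec eb La) → Vanishes (branch n Lc Lb La ea eb ec)
  branch-vanishes₃ n Lc Lb La ea eb ec V F =
    vanishes-⊗ʳ (Linear-dimerSum n Lc eb ea) (vanishes-⊗ʳ (Linear-dimerSum n ec Lb ea) V) (λ a → F (bit ec + a))

  sumB-select : ∀ (f : Bool → ℕ) b → f (not b) ≡ 0 → sumB f ≡ f b
  sumB-select f false f-true≡0  = trans (cong (f false +_) f-true≡0) (+-identityʳ (f false))
  sumB-select f true  f-false≡0 = cong (_+ f true) f-false≡0

  reduced-recurrence : ∀ {n} → EvenVanish n → ∀ Lc Lb La F →
    dimerSum (suc n) Lc Lb La F ≡ sumB λ ea → branch n Lc Lb La ea (forced Lc ea) (forced Lb ea) F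
  reduced-recurrence {n} V Lc Lb La F =
    trans (recurrence n Lc Lb La F)
          (sumB-cong λ ea →
            trans (sumB-select (λ eb → sumB λ ec → branch n Lc Lb La ea eb ec F) (forced Lc ea) (wrong-eb ea))
                  (sumB-select (λ ec → branch n Lc Lb La ea (forced Lc ea) ec F) (forced Lb ea) (wrong-ec ea)))
    where
    wrong-eb : ∀ ea → sumB (λ ec → branch n Lc Lb La ea (not (forced Lc ea)) ec F) ≡ 0
    wrong-eb ea = cong₂ _+_ (branch-vanishes₁ n Lc Lb La ea (not (forced Lc ea)) false first≡0 F)
                            (branch-vanishes₁ n Lc Lb La ea (not (forced Lc ea)) true first≡0 F)
      where first≡0 = V Lc (not (forced Lc ea)) ea (first-even Lc ea)
    wrong-ec : ∀ ea → branch n Lc Lb La ea (forced Lc ea) (not (forced Lb ea)) F ≡ 0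
    wrong-ec ea = branch-vanishes₂ n Lc Lb La ea (forced Lc ea) (not (forced Lb ea))
                    (V (not (forced Lb ea)) Lb ea (second-even Lb ea)) F

  -- Σ_0 is one vertex carrying three loops, which an even number of them does
  -- not cover exactly once; in Σ_{n+1} the third copy of each surviving branch
  -- has the (even) parity of the loops of Σ_{n+1}.
  even-vanish : ∀ n → EvenVanish n
  even-vanish zero false false false _ F = refl
  even-vanish zero false true  true  _ F = refl
  even-vanish zero true  false true  _ F = refl
  even-vanish zero true  true  false _ F = refl
  even-vanish (suc n) Lc Lb La even F =
    trans (reduced-recurrence {n} (even-vanish n) Lc Lb La F) (cong₂ _+_ (third≡0 false) (third≡0 true))
    where
    third≡0 : ∀ ea → branch n Lc Lb La ea (forced Lc ea) (forced Lb ea) F ≡ 0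
    third≡0 ea = branch-vanishes₃ n Lc Lb La ea (forced Lc ea) (forced Lb ea)
                   (even-vanish n (forced Lb ea) (forced Lc ea) La (trans (third-parity Lc Lb La ea) even)) F

  -- Number of coverings with a given odd set of loops, in Σ_{k+1}.
  numCoverings : ℕ → ℕ
  numCoverings zero    = 1
  numCoverings (suc k) = 2 * (numCoverings k * (numCoverings k * numCoverings k))

  -- j k = (3^k − 2k − 1)/4 is the variance parameter; the mean of the c-count
  -- is mean k = 2 j k + k = (3^k − 1)/2 (up to the shifts below).
  j : ℕ → ℕ
  j zero    = 0
  j (suc k) = 3 * j k + k

  mean : ℕ → ℕ
  mean k = 2 * j k + k

  record OddLaws (k : ℕ) : Set where
    field
      law₀₀₁ : Law (dimerSum (suc k) false false true)  (numCoverings k) (mean k)       (3 * j k + k)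
      law₀₁₀ : Law (dimerSum (suc k) false true  false) (numCoverings k) (mean k)       (3 * j k + k)
      law₁₀₀ : Law (dimerSum (suc k) true  false false) (numCoverings k) (suc (mean k)) (3 * j k + 4 * k)
      law₁₁₁ : Law (dimerSum (suc k) true  true  true)  (numCoverings k) (mean k)       (3 * j k)
  open OddLaws

  oddLaws₀ : OddLaws 0
  oddLaws₀ = record
    { law₀₀₁ = record { mass = refl ; first = refl ; second = refl }
    ; law₀₁₀ = record { mass = refl ; first = refl ; second = refl }
    ; law₁₀₀ = record { mass = refl ; first = refl ; second = refl }
    ; law₁₁₁ = record { mass = refl ; first = refl ; second = refl } }

  -- Each odd dimer sum of Σ_{k+2} is the sum of two branches, each a shifted
  -- convolution of three odd dimer sums of Σ_{k+1}; Law-⊗₃ and Law-mix give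
  -- its law, the side conditions being polynomial identities in j k and k.
  module Step (k : ℕ) (L : OddLaws k) where
    private
      n = suc k
      X = dimerSum n

      lin : ∀ p q r → Linear (X p q r)
      lin = Linear-dimerSum n

      -- Loops 001: branches (010,100,111) shifted by 1 and (001,001,001).
      means₀₀₁ : ∀ j k → let m = 2 * j + k in
        1 + (m + (suc m + m)) + (0 + (m + (m + m))) ≡ 2 * (2 * (3 * j + k) + suc k)
      means₀₀₁ = solve-∀
      squares₀₀₁ : ∀ j k → let m = 2 * j + k ; μ₁ = 1 + (m + (suc m + m)) ; μ₂ = 0 + (m + (m + m))
                               μ = 2 * (3 * j + k) + suc k in
        μ₁ * μ₁ + ((3 * j + k) + ((3 * j + 4 * k) + 3 * j)) + (μ₂ * μ₂ + ((3 * j + k) + ((3 * j + k) + (3 * j + k))))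
        ≡ 2 * (μ * μ + (3 * (3 * j + k) + suc k))
      squares₀₀₁ = solve-∀

      -- Loops 010: branches (010,010,010) and (001,111,100) shifted by 1.
      means₀₁₀ : ∀ j k → let m = 2 * j + k in
        0 + (m + (m + m)) + (1 + (m + (m + suc m))) ≡ 2 * (2 * (3 * j + k) + suc k)
      means₀₁₀ = solve-∀
      squares₀₁₀ : ∀ j k → let m = 2 * j + k ; μ₁ = 0 + (m + (m + m)) ; μ₂ = 1 + (m + (m + suc m))
                               μ = 2 * (3 * j + k) + suc k in
        μ₁ * μ₁ + ((3 * j + k) + ((3 * j + k) + (3 * j + k))) + (μ₂ * μ₂ + ((3 * j + k) + (3 * j + (3 * j + 4 * k))))
        ≡ 2 * (μ * μ + (3 * (3 * j + k) + suc k))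
      squares₀₁₀ = solve-∀

      -- Loops 100: branches (100,100,100) shifted by 1 and (111,001,010).
      means₁₀₀ : ∀ j k → let m = 2 * j + k in
        1 + (suc m + (suc m + suc m)) + (0 + (m + (m + m))) ≡ 2 * suc (2 * (3 * j + k) + suc k)
      means₁₀₀ = solve-∀
      squares₁₀₀ : ∀ j k → let m = 2 * j + k ; μ₁ = 1 + (suc m + (suc m + suc m)) ; μ₂ = 0 + (m + (m + m))
                               μ = suc (2 * (3 * j + k) + suc k) in
        μ₁ * μ₁ + ((3 * j + 4 * k) + ((3 * j + 4 * k) + (3 * j + 4 * k)))
          + (μ₂ * μ₂ + (3 * j + ((3 * j + k) + (3 * j + k))))
        ≡ 2 * (μ * μ + (3 * (3 * j + k) + 4 * suc k))
      squares₁₀₀ = solve-∀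

      -- Loops 111: branches (100,010,001) and (111,111,111) shifted by 1.
      means₁₁₁ : ∀ j k → let m = 2 * j + k in
        0 + (suc m + (m + m)) + (1 + (m + (m + m))) ≡ 2 * (2 * (3 * j + k) + suc k)
      means₁₁₁ = solve-∀
      squares₁₁₁ : ∀ j k → let m = 2 * j + k ; μ₁ = 0 + (suc m + (m + m)) ; μ₂ = 1 + (m + (m + m))
                               μ = 2 * (3 * j + k) + suc k in
        μ₁ * μ₁ + ((3 * j + 4 * k) + ((3 * j + k) + (3 * j + k))) + (μ₂ * μ₂ + (3 * j + (3 * j + 3 * j)))
        ≡ 2 * (μ * μ + 3 * (3 * j + k))
      squares₁₁₁ = solve-∀

    oddLaws-step : EvenVanish n → OddLaws (suc k)
    oddLaws-step V = record
      { law₀₀₁ = Moments-≗ (reduced-recurrence {n} V false false true)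
                   (Law-mix (mean (suc k)) (3 * j (suc k) + suc k)
                     (Law-⊗₃ (lin false true false) (lin true false false) (lin true true true)
                             (law₀₁₀ L) (law₁₀₀ L) (law₁₁₁ L) 1)
                     (Law-⊗₃ (lin false false true) (lin false false true) (lin false false true)
                             (law₀₀₁ L) (law₀₀₁ L) (law₀₀₁ L) 0)
                     (means₀₀₁ (j k) k) (squares₀₀₁ (j k) k))
      ; law₀₁₀ = Moments-≗ (reduced-recurrence {n} V false true false)
                   (Law-mix (mean (suc k)) (3 * j (suc k) + suc k)
                     (Law-⊗₃ (lin false true false) (lin false true false) (lin false true false)
                             (law₀₁₀ L) (law₀₁₀ L) (law₀₁₀ L) 0)
                     (Law-⊗₃ (lin false false true) (lin true true true) (lin true false false)
                             (law₀₀₁ L) (law₁₁₁ L) (law₁₀₀ L) 1)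
                     (means₀₁₀ (j k) k) (squares₀₁₀ (j k) k))
      ; law₁₀₀ = Moments-≗ (reduced-recurrence {n} V true false false)
                   (Law-mix (suc (mean (suc k))) (3 * j (suc k) + 4 * suc k)
                     (Law-⊗₃ (lin true false false) (lin true false false) (lin true false false)
                             (law₁₀₀ L) (law₁₀₀ L) (law₁₀₀ L) 1)
                     (Law-⊗₃ (lin true true true) (lin false false true) (lin false true false)
                             (law₁₁₁ L) (law₀₀₁ L) (law₀₁₀ L) 0)
                     (means₁₀₀ (j k) k) (squares₁₀₀ (j k) k))
      ; law₁₁₁ = Moments-≗ (reduced-recurrence {n} V true true true)
                   (Law-mix (mean (suc k)) (3 * j (suc k))
                     (Law-⊗₃ (lin true false false) (lin false true false) (lin false false true)
                             (law₁₀₀ L) (law₀₁₀ L) (law₀₀₁ L) 0)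
                     (Law-⊗₃ (lin true true true) (lin true true true) (lin true true true)
                             (law₁₁₁ L) (law₁₁₁ L) (law₁₁₁ L) 1)
                     (means₁₁₁ (j k) k) (squares₁₁₁ (j k) k)) }

  oddLaws : ∀ k → OddLaws k
  oddLaws zero    = oddLaws₀
  oddLaws (suc k) = Step.oddLaws-step k (oddLaws k) (even-vanish (suc k))

module Types where

  open import Data.Nat using (ℕ; _+_; _*_)
  open import Data.Nat.Properties using (+-identityʳ)
  open import Data.Nat.ListAction using (sum)
  open import Data.Bool using (Bool; true; false; not)
  import Data.Bool.Properties as Bool
  open import Data.Unit using (⊤; tt)
  open import Data.Empty using (⊥; ⊥-elim)
  open import Data.List using (List; map)
  open import Data.List.Properties using (map-∘)
  open import Data.List.Relation.Unary.All as All using (All)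
  import Data.List.Relation.Unary.All.Properties as All
  open import Data.List.Relation.Unary.Any using (here; there)
  open import Data.List.Membership.Propositional using (_∈_)
  open import Data.Sum using (_⊎_; inj₁; inj₂)
  open import Data.Product using (_×_; _,_)
  open import Relation.Binary.PropositionalEquality
  open import Relation.Nullary using (Dec; yes; no; ¬?)
  open import Relation.Nullary.Decidable using (_×-dec_)
  open import Data.Nat.Tactic.RingSolver using (solve-∀)
  open import Defs
  open SubsetSums
  open Graph using (plainEdges)
  open Cover using (bit; keep; withLoops)
  open Moments using (shift)
  open Recurrence

  IsEdge : ∀ {n} → Edge n → Set
  IsEdge (edge _ _ _) = ⊤
  IsEdge (loop _ _)   = ⊥

  plainEdges-loopFree : ∀ n → All IsEdge (plainEdges n)
  plainEdges-loopFree n = All.++⁺ (loopFree a) (All.++⁺ (loopFree b) (loopFree c))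
    where
    loopFree : ∀ s → All IsEdge (edgesOf n s)
    loopFree s = All.map⁺ (All.universal (λ _ → tt) _)

  ∈-keep⁻ : {A : Set} (p : Bool) (x y : A) (d : List A) → y ∈ keep p x d → (p ≡ true × y ≡ x) ⊎ y ∈ d
  ∈-keep⁻ true  x y d (here y≡x)  = inj₁ (refl , y≡x)
  ∈-keep⁻ true  x y d (there y∈d) = inj₂ y∈d
  ∈-keep⁻ false x y d y∈d         = inj₂ y∈d

  ∈-keep⁺ : {A : Set} (p : Bool) (x y : A) (d : List A) → y ∈ d → y ∈ keep p x d
  ∈-keep⁺ true  x y d y∈d = there y∈d
  ∈-keep⁺ false x y d y∈d = y∈d

  loop0-∈ : ∀ n pc pb pa d → All IsEdge d → loop0 n ∈ withLoops n pc pb pa d → pc ≡ true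
  loop0-∈ n pc pb pa d loopFree ∈D with ∈-keep⁻ pc _ _ _ ∈D
  ... | inj₁ (pc≡true , _) = pc≡true
  ... | inj₂ ∈D′ with ∈-keep⁻ pb _ _ _ ∈D′
  ...   | inj₁ (_ , ()) 
  ...   | inj₂ ∈D″ with ∈-keep⁻ pa _ _ _ ∈D″
  ...     | inj₁ (_ , ())
  ...     | inj₂ ∈d = ⊥-elim (All.lookup loopFree ∈d)

  loop1-∈ : ∀ n pc pb pa d → All IsEdge d → loop1 n ∈ withLoops n pc pb pa d → pb ≡ true
  loop1-∈ n pc pb pa d loopFree ∈D with ∈-keep⁻ pc _ _ _ ∈D
  ... | inj₁ (_ , ())
  ... | inj₂ ∈D′ with ∈-keep⁻ pb _ _ _ ∈D′
  ...   | inj₁ (pb≡true , _) = pb≡true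
  ...   | inj₂ ∈D″ with ∈-keep⁻ pa _ _ _ ∈D″
  ...     | inj₁ (_ , ())
  ...     | inj₂ ∈d = ⊥-elim (All.lookup loopFree ∈d)

  loop2-∈ : ∀ n pc pb pa d → All IsEdge d → loop2 n ∈ withLoops n pc pb pa d → pa ≡ true
  loop2-∈ n pc pb pa d loopFree ∈D with ∈-keep⁻ pc _ _ _ ∈D
  ... | inj₁ (_ , ())
  ... | inj₂ ∈D′ with ∈-keep⁻ pb _ _ _ ∈D′
  ...   | inj₁ (_ , ())
  ...   | inj₂ ∈D″ with ∈-keep⁻ pa _ _ _ ∈D″
  ...     | inj₁ (pa≡true , _) = pa≡true
  ...     | inj₂ ∈d = ⊥-elim (All.lookup loopFree ∈d)

  ∈-loop0 : ∀ n pb pa d → loop0 n ∈ withLoops n true pb pa d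
  ∈-loop0 n pb pa d = here refl

  ∈-loop1 : ∀ n pc pa d → loop1 n ∈ withLoops n pc true pa d
  ∈-loop1 n pc pa d = ∈-keep⁺ pc _ _ _ (here refl)

  ∈-loop2 : ∀ n pc pb d → loop2 n ∈ withLoops n pc pb true d
  ∈-loop2 n pc pb d = ∈-keep⁺ pc _ _ _ (∈-keep⁺ pb _ _ _ (here refl))

  𝟙-bit : ∀ {p} {P : Set p} (dP : Dec P) (x : Bool) → (P → x ≡ true) → (x ≡ true → P) → 𝟙 dP ≡ bit x
  𝟙-bit dP x to from = trans (𝟙-cong dP (x Bool.≟ true) to from) (bit-≟ x)
    where
    bit-≟ : ∀ x → 𝟙 (x Bool.≟ true) ≡ bit x
    bit-≟ true  = refl
    bit-≟ false = refl

  𝟙-¬ : ∀ {p} {P : Set p} (dP : Dec P) (x : Bool) → 𝟙 dP ≡ bit x → 𝟙 (¬? dP) ≡ bit (not x)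
  𝟙-¬ (yes _) true  _ = refl
  𝟙-¬ (no _)  false _ = refl

  typeIndicator : CovType → Bool → Bool → Bool → ℕ
  typeIndicator I   pc pb pa = bit pc * (bit pb * bit pa)
  typeIndicator II  pc pb pa = bit pc * (bit (not pb) * bit (not pa))
  typeIndicator III pc pb pa = bit (not pc) * (bit pb * bit (not pa))

  𝟙-hasType : ∀ n T pc pb pa d → All IsEdge d →
              𝟙 (hasType? n T (withLoops n pc pb pa d)) ≡ typeIndicator T pc pb pa
  𝟙-hasType n T pc pb pa d loopFree = by-type T
    where
    D = withLoops n pc pb pa d
    has0 = loop0 n ∈E? D
    has1 = loop1 n ∈E? D
    has2 = loop2 n ∈E? D
    𝟙₀ : 𝟙 has0 ≡ bit pc
    𝟙₀ = 𝟙-bit has0 pc (loop0-∈ n pc pb pa d loopFree) (λ { refl → ∈-loop0 n pb pa d })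
    𝟙₁ : 𝟙 has1 ≡ bit pb
    𝟙₁ = 𝟙-bit has1 pb (loop1-∈ n pc pb pa d loopFree) (λ { refl → ∈-loop1 n pc pa d })
    𝟙₂ : 𝟙 has2 ≡ bit pa
    𝟙₂ = 𝟙-bit has2 pa (loop2-∈ n pc pb pa d loopFree) (λ { refl → ∈-loop2 n pc pb d })
    by-type : ∀ T → 𝟙 (hasType? n T D) ≡ typeIndicator T pc pb pa
    by-type I   = trans (𝟙-× has0 _) (cong₂ _*_ 𝟙₀ (trans (𝟙-× has1 has2) (cong₂ _*_ 𝟙₁ 𝟙₂)))
    by-type II  = trans (𝟙-× has0 _) (cong₂ _*_ 𝟙₀ (trans (𝟙-× (¬? has1) (¬? has2))
                    (cong₂ _*_ (𝟙-¬ has1 pb 𝟙₁) (𝟙-¬ has2 pa 𝟙₂))))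
    by-type III = trans (𝟙-× (¬? has0) _) (cong₂ _*_ (𝟙-¬ has0 pc 𝟙₀)
                    (trans (𝟙-× has1 (¬? has2)) (cong₂ _*_ 𝟙₁ (𝟙-¬ has2 pa 𝟙₂))))

  typeSum : ∀ n → CovType → (ℕ → ℕ) → ℕ
  typeSum n T F = sum (map F (map cCount (coverings n T)))

  -- Splitting a covering into its loops and its loop-free part.
  typeSum-loops : ∀ n T F → typeSum n T F ≡
    sumB λ pc → sumB λ pb → sumB λ pa → typeIndicator T pc pb pa * shift (bit pc) (dimerSum n pc pb pa) F
  typeSum-loops n T F = begin
    sum (map F (map cCount (coverings n T)))
      ≡⟨ cong sum (map-∘ (coverings n T)) ⟨
    sum (map (λ D → F (cCount D)) (filter P? (sublists (edgesΣ n))))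
      ≡⟨ sum-filter P? (λ D → F (cCount D)) (sublists (edgesΣ n)) ⟩
    sum (map (λ D → 𝟙 (P? D) * F (cCount D)) (sublists (edgesΣ n)))
      ≡⟨ Σ⊆-sublists (edgesΣ n) _ ⟩
    Σ⊆ (edgesΣ n) (λ D → 𝟙 (P? D) * F (cCount D))
      ≡⟨ sumB-cong (λ pc → sumB-cong (λ pb → sumB-cong (λ pa → by-loops pc pb pa))) ⟩
    (sumB λ pc → sumB λ pb → sumB λ pa → typeIndicator T pc pb pa * shift (bit pc) (dimerSum n pc pb pa) F) ∎
    where
    open ≡-Reasoning
    open Data.List using (filter)
    P? = λ D → isDimerCovering? n D ×-dec hasType? n T D
    reorder : ∀ x t f → (x * t) * f ≡ t * (x * f)
    reorder = solve-∀
    summand : ∀ pc pb pa d → All IsEdge d →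
      𝟙 (P? (withLoops n pc pb pa d)) * F (cCount (withLoops n pc pb pa d))
      ≡ typeIndicator T pc pb pa * (isCovering n pc pb pa d * F (bit pc + cCount d))
    summand pc pb pa d loopFree =
      trans (cong₂ _*_ (trans (𝟙-× (isDimerCovering? n D) (hasType? n T D))
                              (cong (isCovering n pc pb pa d *_) (𝟙-hasType n T pc pb pa d loopFree)))
                       (cong F (cCount-withLoops n pc pb pa d)))
            (reorder (isCovering n pc pb pa d) _ _)
      where D = withLoops n pc pb pa d
    by-loops : ∀ pc pb pa →
      Σ⊆ (plainEdges n) (λ d → 𝟙 (P? (withLoops n pc pb pa d)) * F (cCount (withLoops n pc pb pa d)))
      ≡ typeIndicator T pc pb pa * shift (bit pc) (dimerSum n pc pb pa) F
    by-loops pc pb pa = trans (Σ⊆-cong-All (plainEdges n) (plainEdges-loopFree n) (summand pc pb pa))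
                              (Σ⊆-* (plainEdges n) (typeIndicator T pc pb pa) _)

  private
    plus-zeros : ∀ y → y + 0 + 0 + 0 ≡ y
    plus-zeros = solve-∀

  -- Type I uses all three loops, type II only the c-loop, type III only the b-loop.
  typeSum-I : ∀ n F → typeSum n I F ≡ shift 1 (dimerSum n true true true) F
  typeSum-I n F = trans (typeSum-loops n I F) (+-identityʳ _)

  typeSum-II : ∀ n F → typeSum n II F ≡ shift 1 (dimerSum n true false false) F
  typeSum-II n F = trans (typeSum-loops n II F) (plus-zeros _)

  typeSum-III : ∀ n F → typeSum n III F ≡ shift 0 (dimerSum n false true false) F
  typeSum-III n F = trans (typeSum-loops n III F) (plus-zeros _)

module Statistics where

  open import Data.Nat as ℕ using (ℕ; suc)
  open import Data.Nat.Properties as ℕ using (+-identityʳ)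
  open import Data.Nat.ListAction using (sum)
  open import Data.Integer as ℤ using (ℤ; +_)
  import Data.Integer.Properties as ℤ
  open import Data.Rational as ℚ using (ℚ; toℚᵘ)
  open import Data.Rational.Properties
    using (toℚᵘ-injective; toℚᵘ-fromℚᵘ; fromℚᵘ-cong; toℚᵘ-homo-+; toℚᵘ-homo-*; toℚᵘ-homo‿-)
  open import Data.Rational.Unnormalised as ℚᵘ using (mkℚᵘ; *≡*)
  import Data.Rational.Unnormalised.Properties as ℚᵘ
  open import Data.List using (List; []; _∷_; map; length; foldr)
  open import Data.List.Properties using (length-map; map-cong; map-id)
  open import Relation.Binary.PropositionalEquality
  open import Data.Integer.Tactic.RingSolver using (solve-∀)
  open import Defs using (meanℚ; sumℚ; fromℕℚ)
  open Moments using (Functional; Law; module Moments)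
  open Moments.Moments

  ι : ℤ → ℚ
  ι z = z ℚ./ 1

  /-≡ : ∀ x y a b → x ℤ.* + suc b ≡ y ℤ.* + suc a → x ℚ./ suc a ≡ y ℚ./ suc b
  /-≡ x y a b eq = fromℚᵘ-cong {mkℚᵘ x a} {mkℚᵘ y b} (*≡* eq)

  private
    ι≃ : ∀ z → toℚᵘ (ι z) ℚᵘ.≃ mkℚᵘ z 0
    ι≃ z = toℚᵘ-fromℚᵘ (mkℚᵘ z 0)

  ι-+ : ∀ x y → ι (x ℤ.+ y) ≡ ι x ℚ.+ ι y
  ι-+ x y = toℚᵘ-injective (ℚᵘ.≃-trans (ι≃ (x ℤ.+ y))
    (ℚᵘ.≃-sym (ℚᵘ.≃-trans (toℚᵘ-homo-+ (ι x) (ι y)) (ℚᵘ.≃-trans (ℚᵘ.+-cong (ι≃ x) (ι≃ y)) (*≡* (unit x y))))))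
    where
    unit : ∀ x y → (x ℤ.* + 1 ℤ.+ y ℤ.* + 1) ℤ.* + 1 ≡ (x ℤ.+ y) ℤ.* + 1
    unit = solve-∀

  ι-* : ∀ x y → ι (x ℤ.* y) ≡ ι x ℚ.* ι y
  ι-* x y = toℚᵘ-injective (ℚᵘ.≃-trans (ι≃ (x ℤ.* y))
    (ℚᵘ.≃-sym (ℚᵘ.≃-trans (toℚᵘ-homo-* (ι x) (ι y)) (ℚᵘ.*-cong (ι≃ x) (ι≃ y)))))

  ι-neg : ∀ x → ι (ℤ.- x) ≡ ℚ.- ι x
  ι-neg x = toℚᵘ-injective (ℚᵘ.≃-trans (ι≃ (ℤ.- x))
    (ℚᵘ.≃-sym (ℚᵘ.≃-trans (toℚᵘ-homo‿- (ι x)) (ℚᵘ.-‿cong (ι≃ x)))))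

  ι-- : ∀ x y → ι (x ℤ.- y) ≡ ι x ℚ.- ι y
  ι-- x y = trans (ι-+ x (ℤ.- y)) (cong (ι x ℚ.+_) (ι-neg y))

  ι-cancel : ∀ L z → ι (+ suc L ℤ.* z) ℚ.* ((+ 1) ℚ./ suc L) ≡ ι z
  ι-cancel L z = toℚᵘ-injective (ℚᵘ.≃-trans (toℚᵘ-homo-* (ι (+ suc L ℤ.* z)) ((+ 1) ℚ./ suc L))
    (ℚᵘ.≃-trans (ℚᵘ.*-cong (ι≃ (+ suc L ℤ.* z)) (toℚᵘ-fromℚᵘ (mkℚᵘ (+ 1) L)))
    (ℚᵘ.≃-trans (*≡* cross) (ℚᵘ.≃-sym (ι≃ z)))))
    where
    cancel : ∀ N z → (N ℤ.* z ℤ.* + 1) ℤ.* + 1 ≡ z ℤ.* N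
    cancel = solve-∀
    cross : (+ suc L ℤ.* z ℤ.* + 1) ℤ.* + 1 ≡ z ℤ.* + suc (L ℕ.+ 0)
    cross rewrite +-identityʳ L = cancel (+ suc L) z

  fromℕℚ-/ : ∀ x d (z : ℤ) → z ≡ + (x ℕ.* suc d) → fromℕℚ x ≡ z ℚ./ suc d
  fromℕℚ-/ x d z z≡ = /-≡ (+ x) z 0 d (trans (sym (ℤ.pos-* x (suc d))) (trans (sym z≡) (sym (ℤ.*-identityʳ z))))

  sumℤ : List ℤ → ℤ
  sumℤ = foldr ℤ._+_ (+ 0)

  sumℚ-ι : ∀ {A : Set} (g : A → ℤ) (xs : List A) → sumℚ (map (λ x → ι (g x)) xs) ≡ ι (sumℤ (map g xs))
  sumℚ-ι g []       = refl
  sumℚ-ι g (x ∷ xs) = trans (cong (ι (g x) ℚ.+_) (sumℚ-ι g xs)) (sym (ι-+ (g x) _))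

  sumℤ-pos : ∀ (vs : List ℕ) → sumℤ (map +_ vs) ≡ + sum vs
  sumℤ-pos []       = refl
  sumℤ-pos (v ∷ vs) = trans (cong (λ s → + v ℤ.+ s) (sumℤ-pos vs)) (sym (ℤ.pos-+ v (sum vs)))

  meanℚ-length : ∀ (qs : List ℚ) L → length qs ≡ suc L → meanℚ qs ≡ sumℚ qs ℚ.* ((+ 1) ℚ./ suc L)
  meanℚ-length (q ∷ qs) L refl = refl

  values : List ℕ → Functional
  values vs F = sum (map F vs)

  length-values : ∀ vs → length vs ≡ values vs (λ _ → 1)
  length-values []       = refl
  length-values (v ∷ vs) = cong suc (length-values vs)

  sum-squares : ∀ (vs : List ℕ) M → sumℤ (map (λ v → (+ v ℤ.- M) ℤ.* (+ v ℤ.- M)) vs) ≡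
    + values vs (λ v → v ℕ.* v) ℤ.- + 2 ℤ.* M ℤ.* + values vs (λ v → v) ℤ.+ + length vs ℤ.* M ℤ.* M
  sum-squares [] M = empty M
    where
    empty : ∀ M → + 0 ≡ + 0 ℤ.- + 2 ℤ.* M ℤ.* + 0 ℤ.+ + 0 ℤ.* M ℤ.* M
    empty = solve-∀
  sum-squares (v ∷ vs) M = begin
    (+ v ℤ.- M) ℤ.* (+ v ℤ.- M) ℤ.+ sumℤ (map (λ v → (+ v ℤ.- M) ℤ.* (+ v ℤ.- M)) vs)
      ≡⟨ cong (λ s → (+ v ℤ.- M) ℤ.* (+ v ℤ.- M) ℤ.+ s) (sum-squares vs M) ⟩
    (+ v ℤ.- M) ℤ.* (+ v ℤ.- M) ℤ.+ (+ Q ℤ.- + 2 ℤ.* M ℤ.* + S ℤ.+ + N ℤ.* M ℤ.* M)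
      ≡⟨ step (+ v) M (+ Q) (+ S) (+ N) ⟩
    (+ v ℤ.* + v ℤ.+ + Q) ℤ.- + 2 ℤ.* M ℤ.* (+ v ℤ.+ + S) ℤ.+ (+ 1 ℤ.+ + N) ℤ.* M ℤ.* M
      ≡⟨ cong₂ (λ q s → q ℤ.- + 2 ℤ.* M ℤ.* s ℤ.+ + suc N ℤ.* M ℤ.* M)
               (trans (cong (ℤ._+ + Q) (sym (ℤ.pos-* v v))) (sym (ℤ.pos-+ (v ℕ.* v) Q)))
               (sym (ℤ.pos-+ v S)) ⟩
    + (v ℕ.* v ℕ.+ Q) ℤ.- + 2 ℤ.* M ℤ.* + (v ℕ.+ S) ℤ.+ + suc N ℤ.* M ℤ.* M ∎
    where
    open ≡-Reasoning
    Q = values vs (λ v → v ℕ.* v)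
    S = values vs (λ v → v)
    N = length vs
    step : ∀ V M Q S N → (V ℤ.- M) ℤ.* (V ℤ.- M) ℤ.+ (Q ℤ.- + 2 ℤ.* M ℤ.* S ℤ.+ N ℤ.* M ℤ.* M) ≡
           (V ℤ.* V ℤ.+ Q) ℤ.- + 2 ℤ.* M ℤ.* (V ℤ.+ S) ℤ.+ (+ 1 ℤ.+ N) ℤ.* M ℤ.* M
    step = solve-∀

  module _ (vs : List ℕ) (L μ v : ℕ) (law : Law (values vs) (suc L) μ v) where

    private
      length≡ : length vs ≡ suc L
      length≡ = trans (length-values vs) (mass law)

    law⇒mean : meanℚ (map fromℕℚ vs) ≡ fromℕℚ μ
    law⇒mean = begin
      meanℚ (map fromℕℚ vs)
        ≡⟨ meanℚ-length (map fromℕℚ vs) L (trans (length-map fromℕℚ vs) length≡) ⟩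
      sumℚ (map fromℕℚ vs) ℚ.* ((+ 1) ℚ./ suc L)
        ≡⟨ cong (ℚ._* ((+ 1) ℚ./ suc L)) (trans (sumℚ-ι +_ vs) (cong ι (sumℤ-pos vs))) ⟩
      ι (+ sum vs) ℚ.* ((+ 1) ℚ./ suc L)
        ≡⟨ cong (λ s → ι (+ s) ℚ.* ((+ 1) ℚ./ suc L)) (cong sum (map-id vs)) ⟨
      ι (+ values vs (λ x → x)) ℚ.* ((+ 1) ℚ./ suc L)
        ≡⟨ cong (λ s → ι s ℚ.* ((+ 1) ℚ./ suc L)) (trans (cong +_ (first law)) (ℤ.pos-* (suc L) μ)) ⟩
      ι (+ suc L ℤ.* + μ) ℚ.* ((+ 1) ℚ./ suc L)
        ≡⟨ ι-cancel L (+ μ) ⟩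
      fromℕℚ μ ∎
      where
      open ≡-Reasoning

    law⇒variance : meanℚ (map (λ x → (fromℕℚ x ℚ.- fromℕℚ μ) ℚ.* (fromℕℚ x ℚ.- fromℕℚ μ)) vs) ≡ fromℕℚ v
    law⇒variance = begin
      meanℚ (map squareℚ vs)
        ≡⟨ meanℚ-length (map squareℚ vs) L (trans (length-map squareℚ vs) length≡) ⟩
      sumℚ (map squareℚ vs) ℚ.* ((+ 1) ℚ./ suc L)
        ≡⟨ cong (λ s → sumℚ s ℚ.* ((+ 1) ℚ./ suc L)) (map-cong squareℚ≡ vs) ⟩
      sumℚ (map (λ x → ι (squareℤ x)) vs) ℚ.* ((+ 1) ℚ./ suc L)
        ≡⟨ cong (ℚ._* ((+ 1) ℚ./ suc L)) (trans (sumℚ-ι squareℤ vs) (cong ι (trans (sum-squares vs (+ μ)) moments))) ⟩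
      ι (+ suc L ℤ.* + v) ℚ.* ((+ 1) ℚ./ suc L)
        ≡⟨ ι-cancel L (+ v) ⟩
      fromℕℚ v ∎
      where
      open ≡-Reasoning
      squareℚ : ℕ → ℚ
      squareℚ x = (fromℕℚ x ℚ.- fromℕℚ μ) ℚ.* (fromℕℚ x ℚ.- fromℕℚ μ)
      squareℤ : ℕ → ℤ
      squareℤ x = (+ x ℤ.- + μ) ℤ.* (+ x ℤ.- + μ)
      squareℚ≡ : ∀ x → squareℚ x ≡ ι (squareℤ x)
      squareℚ≡ x = sym (trans (ι-* (+ x ℤ.- + μ) _) (cong₂ ℚ._*_ (ι-- (+ x) (+ μ)) (ι-- (+ x) (+ μ))))
      variance : ∀ N M V → N ℤ.* (M ℤ.* M ℤ.+ V) ℤ.- + 2 ℤ.* M ℤ.* (N ℤ.* M) ℤ.+ N ℤ.* M ℤ.* M ≡ N ℤ.* V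
      variance = solve-∀
      moments : + values vs (λ x → x ℕ.* x) ℤ.- + 2 ℤ.* + μ ℤ.* + values vs (λ x → x) ℤ.+ + length vs ℤ.* + μ ℤ.* + μ
                ≡ + suc L ℤ.* + v
      moments = begin
        + values vs (λ x → x ℕ.* x) ℤ.- + 2 ℤ.* + μ ℤ.* + values vs (λ x → x) ℤ.+ + length vs ℤ.* + μ ℤ.* + μ
          ≡⟨ cong (λ N → + values vs (λ x → x ℕ.* x) ℤ.- + 2 ℤ.* + μ ℤ.* + values vs (λ x → x) ℤ.+ + N ℤ.* + μ ℤ.* + μ)
                  length≡ ⟩
        + values vs (λ x → x ℕ.* x) ℤ.- + 2 ℤ.* + μ ℤ.* + values vs (λ x → x) ℤ.+ + suc L ℤ.* + μ ℤ.* + μ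
          ≡⟨ cong₂ (λ q s → q ℤ.- + 2 ℤ.* + μ ℤ.* s ℤ.+ + suc L ℤ.* + μ ℤ.* + μ)
                   (trans (cong +_ (second law)) (trans (ℤ.pos-* (suc L) _)
                          (cong (+ suc L ℤ.*_) (trans (ℤ.pos-+ (μ ℕ.* μ) v) (cong (ℤ._+ + v) (ℤ.pos-* μ μ))))))
                   (trans (cong +_ (first law)) (ℤ.pos-* (suc L) μ))
             ⟩
        + suc L ℤ.* (+ μ ℤ.* + μ ℤ.+ + v) ℤ.- + 2 ℤ.* + μ ℤ.* (+ suc L ℤ.* + μ) ℤ.+ + suc L ℤ.* + μ ℤ.* + μ
          ≡⟨ variance (+ suc L) (+ μ) (+ v) ⟩
        + suc L ℤ.* + v ∎

module Formulas where

  open import Data.Nat as ℕ using (ℕ; zero; suc; _+_; _*_; _^_)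
  open import Data.Bool using (true; false)
  open import Data.Integer as ℤ using (+_)
  import Data.Integer.Properties as ℤ
  open import Data.Rational as ℚ using (ℚ)
  open import Data.List using (map)
  open import Data.List.Properties using (map-∘)
  open import Data.Product using (_×_; _,_; proj₁; proj₂)
  open import Relation.Binary.PropositionalEquality
  import Data.Nat.Tactic.RingSolver as ℕ-Solver
  import Data.Integer.Tactic.RingSolver as ℤ-Solver
  open import Defs
  open Moments
  open Recurrence using (Linear-dimerSum)
  open Laws using (oddLaws; numCoverings; j; mean; module OddLaws)
  open Types using (typeSum-I; typeSum-II; typeSum-III)
  open Statistics

  TypeLaw : ℕ → CovType → ℕ → ℕ → Set
  TypeLaw k T μ v = Law (values (map cCount (coverings (suc k) T))) (numCoverings k) μ v

  -- A type-I covering is a loop-free set completing all three loops, plus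
  -- the c-loop; similarly for types II and III.
  law-I : ∀ k → TypeLaw k I (1 + mean k) (3 * j k)
  law-I k = Moments-≗ (typeSum-I (suc k))
              (Law-shift 1 (Linear-dimerSum (suc k) true true true) (OddLaws.law₁₁₁ (oddLaws k)))

  law-II : ∀ k → TypeLaw k II (1 + suc (mean k)) (3 * j k + 4 * k)
  law-II k = Moments-≗ (typeSum-II (suc k))
               (Law-shift 1 (Linear-dimerSum (suc k) true false false) (OddLaws.law₁₀₀ (oddLaws k)))

  law-III : ∀ k → TypeLaw k III (0 + mean k) (3 * j k + k)
  law-III k = Moments-≗ (typeSum-III (suc k))
                (Law-shift 0 (Linear-dimerSum (suc k) false true false) (OddLaws.law₀₁₀ (oddLaws k)))

  -- There are coverings of each odd loop configuration.
  numCoverings-suc : ∀ k → numCoverings k ≡ suc (ℕ.pred (numCoverings k))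
  numCoverings-suc zero    = refl
  numCoverings-suc (suc k) rewrite numCoverings-suc k = refl

  mean-variance : ∀ k T μᵢ vᵢ → TypeLaw k T μᵢ vᵢ → (μ (suc k) T ≡ fromℕℚ μᵢ) × (σ² (suc k) T ≡ fromℕℚ vᵢ)
  mean-variance k T μᵢ vᵢ law = mean≡ , variance≡
    where
    Ds = coverings (suc k) T
    cs = map cCount Ds
    law′ : Law (values cs) (suc (ℕ.pred (numCoverings k))) μᵢ vᵢ
    law′ = subst (λ N → Law (values cs) N μᵢ vᵢ) (numCoverings-suc k) law
    mean≡ : μ (suc k) T ≡ fromℕℚ μᵢ
    mean≡ = trans (cong meanℚ (map-∘ Ds)) (law⇒mean cs _ μᵢ vᵢ law′)
    variance≡ : σ² (suc k) T ≡ fromℕℚ vᵢ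
    variance≡ = trans (cong meanℚ (trans (cong (λ m → map (λ D → square (fromℕℚ (cCount D) ℚ.- m)) Ds) mean≡)
                                         (map-∘ Ds)))
                      (law⇒variance cs _ μᵢ vᵢ law′)
      where
      square : ℚ → ℚ
      square d = d ℚ.* d

  three^ : ∀ k → 3 ^ k ≡ 2 * mean k + 1
  three^ zero    = refl
  three^ (suc k) = trans (cong (3 *_) (three^ k)) (step (j k) k)
    where
    step : ∀ j k → 3 * (2 * (2 * j + k) + 1) ≡ 2 * (2 * (3 * j + k) + suc k) + 1
    step = ℕ-Solver.solve-∀

  minus : ∀ A B R → A ≡ R + B → + A ℤ.- + B ≡ + R
  minus A B R A≡ = trans (cong (λ x → x ℤ.- + B) (trans (cong +_ A≡) (ℤ.pos-+ R B))) (cancel (+ R) (+ B))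
    where
    cancel : ∀ r b → r ℤ.+ b ℤ.- b ≡ r
    cancel = ℤ-Solver.solve-∀

  minus-plus : ∀ A B C R → A + C ≡ R + B → + A ℤ.- + B ℤ.+ + C ≡ + R
  minus-plus A B C R eq = trans (reorder (+ A) (+ B) (+ C)) (minus (A + C) B R eq)
    where
    reorder : ∀ x y z → x ℤ.- y ℤ.+ z ≡ x ℤ.+ z ℤ.- y
    reorder = ℤ-Solver.solve-∀

  minus-minus : ∀ A B C R → A ≡ R + (B + C) → + A ℤ.- + B ℤ.- + C ≡ + R
  minus-minus A B C R eq = trans (reorder (+ A) (+ B) (+ C)) (minus A (B + C) R eq)
    where
    reorder : ∀ x y z → x ℤ.- y ℤ.- z ≡ x ℤ.- (y ℤ.+ z)
    reorder = ℤ-Solver.solve-∀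

  private
    statsI   = λ k → mean-variance k I   _ _ (law-I k)
    statsII  = λ k → mean-variance k II  _ _ (law-II k)
    statsIII = λ k → mean-variance k III _ _ (law-III k)

  -- In each case the numerator of the target fraction is (denominator) × (the
  -- natural number given by the law), by 3^k = 2 mean k + 1 and a ring identity.
  μ-I : ∀ k → μ (suc k) I ≡ (+ (3 ^ k) ℤ.+ + 1) ℚ./ 2
  μ-I k = trans (proj₁ (statsI k)) (fromℕℚ-/ (1 + mean k) 1 _ (cong +_ numerator))
    where
    identity : ∀ j k → 2 * (2 * j + k) + 1 + 1 ≡ (1 + (2 * j + k)) * 2
    identity = ℕ-Solver.solve-∀
    numerator : 3 ^ k + 1 ≡ (1 + mean k) * 2
    numerator = trans (cong (_+ 1) (three^ k)) (identity (j k) k)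

  μ-II : ∀ k → μ (suc k) II ≡ (+ (3 ^ k) ℤ.+ + 3) ℚ./ 2
  μ-II k = trans (proj₁ (statsII k)) (fromℕℚ-/ (1 + suc (mean k)) 1 _ (cong +_ numerator))
    where
    identity : ∀ j k → 2 * (2 * j + k) + 1 + 3 ≡ (1 + suc (2 * j + k)) * 2
    identity = ℕ-Solver.solve-∀
    numerator : 3 ^ k + 3 ≡ (1 + suc (mean k)) * 2
    numerator = trans (cong (_+ 3) (three^ k)) (identity (j k) k)

  μ-III : ∀ k → μ (suc k) III ≡ (+ (3 ^ k) ℤ.- + 1) ℚ./ 2
  μ-III k = trans (proj₁ (statsIII k)) (fromℕℚ-/ (0 + mean k) 1 _ (minus (3 ^ k) 1 _ numerator))
    where
    identity : ∀ j k → 2 * (2 * j + k) + 1 ≡ (0 + (2 * j + k)) * 2 + 1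
    identity = ℕ-Solver.solve-∀
    numerator : 3 ^ k ≡ (0 + mean k) * 2 + 1
    numerator = trans (three^ k) (identity (j k) k)

  σ²-I : ∀ k → σ² (suc k) I ≡ (+ (3 ^ suc k) ℤ.- + (6 * suc k) ℤ.+ + 3) ℚ./ 4
  σ²-I k = trans (proj₂ (statsI k)) (fromℕℚ-/ (3 * j k) 3 _ (minus-plus (3 ^ suc k) (6 * suc k) 3 _ numerator))
    where
    identity : ∀ j k → 3 * (2 * (2 * j + k) + 1) + 3 ≡ 3 * j * 4 + 6 * suc k
    identity = ℕ-Solver.solve-∀
    numerator : 3 ^ suc k + 3 ≡ 3 * j k * 4 + 6 * suc k
    numerator = trans (cong (λ p → 3 * p + 3) (three^ k)) (identity (j k) k)

  σ²-II : ∀ k → σ² (suc k) II ≡ (+ (3 ^ suc k) ℤ.+ + (10 * suc k) ℤ.- + 13) ℚ./ 4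
  σ²-II k = trans (proj₂ (statsII k)) (fromℕℚ-/ (3 * j k + 4 * k) 3 _ (minus (3 ^ suc k + 10 * suc k) 13 _ numerator))
    where
    identity : ∀ j k → 3 * (2 * (2 * j + k) + 1) + 10 * suc k ≡ (3 * j + 4 * k) * 4 + 13
    identity = ℕ-Solver.solve-∀
    numerator : 3 ^ suc k + 10 * suc k ≡ (3 * j k + 4 * k) * 4 + 13
    numerator = trans (cong (λ p → 3 * p + 10 * suc k) (three^ k)) (identity (j k) k)

  σ²-III : ∀ k → σ² (suc k) III ≡ (+ (3 ^ suc k) ℤ.- + (2 * suc k) ℤ.- + 1) ℚ./ 4
  σ²-III k = trans (proj₂ (statsIII k)) (fromℕℚ-/ (3 * j k + k) 3 _ (minus-minus (3 ^ suc k) (2 * suc k) 1 _ numerator))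
    where
    identity : ∀ j k → 3 * (2 * (2 * j + k) + 1) ≡ (3 * j + k) * 4 + (2 * suc k + 1)
    identity = ℕ-Solver.solve-∀
    numerator : 3 ^ suc k ≡ (3 * j k + k) * 4 + (2 * suc k + 1)
    numerator = trans (cong (3 *_) (three^ k)) (identity (j k) k)

open import Defs
open import Data.Nat using (ℕ; _≤_; _∸_; _^_)
open import Data.Integer using (+_; _-_; _+_)
open import Data.Rational using (ℚ; _/_)
open import Data.Product using (_×_)
open import Relation.Binary.PropositionalEquality using (_≡_)
open import Data.Nat using (suc)
open import Data.Product using (_,_)
open Formulas using (μ-I; μ-II; μ-III; σ²-I; σ²-II; σ²-III)

theorem5p1 : (n : ℕ) → 1 ≤ n →
      (μ n I   ≡ (+ (3 ^ (n ∸ 1)) + + 1) / 2)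
    × (μ n II  ≡ (+ (3 ^ (n ∸ 1)) + + 3) / 2)
    × (μ n III ≡ (+ (3 ^ (n ∸ 1)) - + 1) / 2)
    × (σ² n I   ≡ (+ (3 ^ n) - + (6 Data.Nat.* n) + + 3) / 4)
    × (σ² n II  ≡ (+ (3 ^ n) + + (10 Data.Nat.* n) - + 13) / 4)
    × (σ² n III ≡ (+ (3 ^ n) - + (2 Data.Nat.* n) - + 1) / 4)
theorem5p1 (suc k) _ = μ-I k , μ-II k , μ-III k , σ²-I k , σ²-II k , σ²-III k
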